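{- Let $n>1$ and let $m$ with $1\le m<n$ satisfy $L(n,m)=L(n)$. There is a set $\Gamma\subseteq\Sigma_n$ of $7$ letters such that for each pair $\langle f,g\rangle$ of $Q(m)$-rankings for $\mathcal{FB}_n$ there is a word $v\in\Gamma^*$ with $v\approx w_{f,g}$.
   Context: For $n>1$, $\mathcal{FB}_n$ is the full Büchi automaton with states $S_n=\{s_0,\dots,s_{n-2},s_f\}$, $S'_n=\{s_0,\dots,s_{n-2}\}$ (initial states), $F_n=\{s_f\}$, alphabet $\Sigma_n=\mathcal{P}(S_n\times S_n)$ and transitions $\langle p,a,q\rangle\in\Delta_n$ iff $\langle p,q\rangle\in a$. For a finite word $w=a(0)\cdots a(l-1)$, $p\xrightarrow{w}q$ means there is $\rho(0)\cdots\rho(l)$ with $\rho(0)=p,\rho(l)=q$ and $\langle\rho(i),a(i),\rho(i+1)\rangle\in\Delta_n$; $p\xrightarrow[F_n]{w}q$ means moreover $\rho(i)\in F_n$ for some $0\le i\le l$. For $u,v\in\Sigma_n^*$, $u\approx v$ iff for all $p,q\in S'_n$: ($p\xrightarrow{u}q\iff p\xrightarrow{v}q$) and ($p\xrightarrow[F_n]{u}q\iff p\xrightarrow[F_n]{v}q$). A $Q(m)$-ranking is a function $h:S'_n\to\{0,\dots,2m-1\}$ attaining every odd value $1,\dots,2m-1$; $L(n,m)$ is their number, $L(n)=\max_{1\le m<n}L(n,m)$. Words $w_{f,g}$: $Rank_h(r)=\{q\in S'_n:h(q)=r\}$; for $T\subseteq S'_n$: $Id(T)=\{\langle q,q\rangle:q\in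 T\}$, $TtoF(T)=Id(S'_n)\cup\{\langle q,s_f\rangle:q\in T\}$, $FtoT(T)=Id(S'_n)\cup\{\langle s_f,q\rangle:q\in T\}$; $c(f,g)=\{\langle p,q\rangle\in S'_n\times S'_n:f(p)=g(q)\text{ odd}\}$; $d(h,r,r')=TtoF(Rank_h(r))\cdot FtoT(Rank_h(r'))$; if $r_1>\dots>r_k$ are the values of $h$, $u_h=d(h,r_1,r_2)\cdots d(h,r_{k-1},r_k)$; $w_{f,g}=u_f\cdot c(f,g)\cdot u_g$. -}

module Defs where

open import Data.Nat using (ℕ; zero; suc; _+_; _*_; _∸_; _≤_; _<_; _⊔_; _≟_)
open import Data.Nat using (_%_)
open import Data.Bool using (Bool; true; false; _∧_)
open import Data.Fin using (Fin; zero; suc; toℕ; fromℕ; inject₁)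
import Data.Fin as F
open import Data.Fin.Properties using (all?; any?)
open import Data.List using (List; []; _∷_; _++_; [_]; length; lookup; map; filter; foldr; downFrom; upTo; concatMap; allFin)
open import Data.Vec as V using (Vec)
open import Data.Product using (Σ; ∃; _×_; _,_)
open import Function.Bundles using (_⇔_)
open import Relation.Nullary using (does)
open import Relation.Binary.PropositionalEquality using (_≡_)

-- States of FB_n: S_n = S'_n ∪ {s_f}, with S'_n = {s_0,…,s_{n-2}} ≅ Fin (n ∸ 1).
-- `s i` is s_i, `sf` is the final state s_f.
S' : ℕ → Set
S' n = Fin (n ∸ 1)

data State (n : ℕ) : Set where
  s  : S' n → State n
  sf : State n

-- A letter of Σ_n = P(S_n × S_n), as a (decidable) relation (characteristic function).
Letter : ℕ → Set
Letter n = State n → State n → Bool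

Word : ℕ → Set
Word n = List (Letter n)

-- A run of FB_n on w from p to q: ρ(0)…ρ(l), with ⟨ρ(i),a(i),ρ(i+1)⟩ ∈ Δ_n,
-- i.e. ⟨ρ(i),ρ(i+1)⟩ ∈ a(i).
IsRun : {n : ℕ} (w : Word n) (p q : State n) (ρ : Fin (suc (length w)) → State n) → Set
IsRun w p q ρ =
  (ρ zero ≡ p) × (ρ (fromℕ (length w)) ≡ q)
  × (∀ (i : Fin (length w)) → lookup w i (ρ (inject₁ i)) (ρ (suc i)) ≡ true)

_⟶[_]_ : {n : ℕ} → State n → Word n → State n → Set
p ⟶[ w ] q = Σ (Fin (suc (length w)) → _) λ ρ → IsRun w p q ρ

_⟶F[_]_ : {n : ℕ} → State n → Word n → State n → Set
p ⟶F[ w ] q = Σ (Fin (suc (length w)) → _) λ ρ → IsRun w p q ρ × ∃ λ i → ρ i ≡ sf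

_≈_ : {n : ℕ} → Word n → Word n → Set
_≈_ {n} u v = ∀ (p q : S' n) →
  ((s p ⟶[ u ] s q) ⇔ (s p ⟶[ v ] s q))
  × ((s p ⟶F[ u ] s q) ⇔ (s p ⟶F[ v ] s q))

IsQRanking : (n m : ℕ) → (S' n → ℕ) → Set
IsQRanking n m h = (∀ q → h q < 2 * m) × (∀ j → j < m → ∃ λ q → h q ≡ suc (2 * j))

-- Counting: enumerate all functions S'_n → {0,…,2m-1} as vectors.
allVecs : (b k : ℕ) → List (Vec (Fin b) k)
allVecs b zero = V.[] ∷ []
allVecs b (suc k) = concatMap (λ x → map (x V.∷_) (allVecs b k)) (allFin b)

attainsOdd? : (n m : ℕ) → Vec (Fin (2 * m)) (n ∸ 1) → Bool
attainsOdd? n m v =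
  does (all? {P = λ (j : Fin m) → ∃ λ (q : S' n) → toℕ (V.lookup v q) ≡ suc (2 * toℕ j)}
         (λ j → any? (λ q → toℕ (V.lookup v q) ≟ suc (2 * toℕ j))))

L : ℕ → ℕ → ℕ
L n m = length (filter (λ v → Data.Bool._≟_ (attainsOdd? n m v) true) (allVecs (2 * m) (n ∸ 1)))
  where import Data.Bool

Lmax : ℕ → ℕ
Lmax n = foldr _⊔_ 0 (map (λ i → L n (suc i)) (upTo (n ∸ 1)))

Rank : (n : ℕ) → (S' n → ℕ) → ℕ → S' n → Bool
Rank n h r q = does (h q ≟ r)

Id : (n : ℕ) → (S' n → Bool) → Letter n
Id n T (s p) (s q) = does (p F.≟ q) ∧ T p
Id n T _ _ = false

TtoF : {n : ℕ} → (S' n → Bool) → Letter n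
TtoF T (s p) (s q) = does (p F.≟ q)
TtoF T (s p) sf = T p
TtoF T sf _ = false

FtoT : {n : ℕ} → (S' n → Bool) → Letter n
FtoT T (s p) (s q) = does (p F.≟ q)
FtoT T sf (s q) = T q
FtoT T _ _ = false

c : (n : ℕ) → (f g : S' n → ℕ) → Letter n
c n f g (s p) (s q) = does (f p ≟ g q) ∧ does (f p % 2 ≟ 1)
c n f g _ _ = false

d : (n : ℕ) → (S' n → ℕ) → ℕ → ℕ → Word n
d n h r r' = TtoF (Rank n h r) ∷ FtoT (Rank n h r') ∷ []

maxVal : (n : ℕ) → (S' n → ℕ) → ℕ
maxVal n h = foldr _⊔_ 0 (map h (allFin (n ∸ 1)))

valuesDesc : (n : ℕ) → (S' n → ℕ) → List ℕ
valuesDesc n h = filter (λ r → any? (λ q → h q ≟ r)) (downFrom (suc (maxVal n h)))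

uFrom : (n : ℕ) → (S' n → ℕ) → List ℕ → Word n
uFrom n h (r ∷ r' ∷ rs) = d n h r r' ++ uFrom n h (r' ∷ rs)
uFrom n h _ = []

u : (n : ℕ) → (S' n → ℕ) → Word n
u n h = uFrom n h (valuesDesc n h)

w : (n : ℕ) → (f g : S' n → ℕ) → Word n
w n f g = u n f ++ [ c n f g ] ++ u n g

-- ≈ only observes paths and F-paths between states of S'_n.  Words with the
-- same such paths *agree*; agreement is a congruence for concatenation when
-- the left factors are *closed* (no path from S'_n to s_f).  As
-- w_{f,g} = u_f · c(f,g) · u_g with u_h a chain of blocks d(h,r,r'), it
-- suffices to find closed Γ-words agreeing with c(f,g) and with each block.
--  * n = 2: u_h agrees with the empty word and c(f,g) with one letter.
--  * n = k + 3: Γ = {ρ, τ, μ, μᵀ, κ, ξ, ξᵀ} (module Generators).  Words over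
--    ρ, τ, μ, κ compute every "classification" of the cells (arrange
--    representatives by transpositions, then collapse by merges and
--    deletions); c(f,g) agrees with the classification by f followed by the
--    converse of the one by g.  A block agrees with ξ-conjugates letting the
--    cells of rank r exit to s_f, the converse word letting s_f enter the
--    cells of rank r', and ττ.  Distinctness is checked at a few entries.
module Submission where

open import Defs
open import Data.Nat using (ℕ; _≤_; _<_)
open import Data.Nat using (zero; suc)
open import Data.Fin using (Fin)
open import Data.List using (List; map)
open import Data.Product using (Σ; _×_)
open import Relation.Nullary using (¬_)
open import Relation.Binary.PropositionalEquality using (_≡_; _≢_)

open import Data.Bool using (Bool; true; false; _∧_)
open import Data.Bool.Properties using (∧-conicalˡ; ∧-conicalʳ)
open import Data.Empty using (⊥; ⊥-elim)
open import Data.Fin using (zero; suc; toℕ; fromℕ; fromℕ<; inject₁; inject≤)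
import Data.Fin.Properties as Fin
open import Data.Fin.Properties
  using (toℕ-injective; toℕ-fromℕ; toℕ-fromℕ<; toℕ-inject₁; toℕ<n; inject≤-injective)
open import Data.Fin.Permutation.Components using (transpose; transpose-inverse)
open import Data.List using ([]; _∷_; _++_; [_]; replicate; concat; concatMap; filter; allFin)
open import Data.List.Properties using (map-cong; map-++)
open import Data.List.Membership.Propositional using (_∈_)
open import Data.List.Membership.Propositional.Properties using (∈-allFin; ∈-filter⁺; ∈-filter⁻)
open import Data.List.Relation.Unary.All using (All; []; _∷_)
import Data.List.Relation.Unary.All as All
open import Data.List.Relation.Unary.All.Properties using () renaming (++⁺ to All-++)
open import Data.List.Relation.Unary.Any using (here; there)
open import Data.List.Relation.Unary.Linked using (Linked; []; [-]; _∷_)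
open import Data.List.Relation.Unary.Linked.Properties using (filter⁺; applyDownFrom⁺₂)
open import Data.Maybe using (Maybe; just; nothing; _>>=_)
import Data.Maybe as Maybe
import Data.Maybe.Properties as Maybe
open import Data.Maybe.Properties using (just-injective)
open import Data.Nat using (s≤s; _+_; _∸_; _*_; _/_; _%_; _>_; _≟_)
open import Data.Nat.Properties
  using (<-trans; <-irrefl; n<1+n; ≤-refl; ≤-pred; <⇒≤; +-comm; +-suc; *-comm; *-cancelʳ-≡; suc-injective;
         m∸n≤m; n∸n≡0; m+[n∸m]≡n; m∸[m∸n]≡n)
open import Data.Nat.DivMod using (m≡m%n+[m/n]*n; [m+kn]%n≡m%n; m<n*o⇒m/o<n)
open import Data.Product using (∃-syntax; _,_; proj₁; proj₂)
open import Data.Sum using (_⊎_; inj₁; inj₂; [_,_]′)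
open import Data.Unit using (⊤; tt)
open import Function using (_∘_)
open import Function.Bundles using (_⇔_; mk⇔; Equivalence)
open import Function.Construct.Composition using (_⇔-∘_)
open import Function.Construct.Identity using (⇔-id)
open import Function.Construct.Symmetry using (⇔-sym)
open import Function.Definitions using (Injective)
open import Relation.Binary.PropositionalEquality
  using (refl; sym; trans; cong; subst; subst₂; module ≡-Reasoning)
open import Relation.Nullary using (Dec; yes; no; does)
open import Relation.Nullary.Decidable using (dec-true; dec-false)

open Equivalence using (to; from)

true≠false : ∀ {x : Bool} → x ≡ true → x ≡ false → ⊥
true≠false refl ()

does⇔ : ∀ {A : Set} (a? : Dec A) → does a? ≡ true ⇔ A
does⇔ (yes a) = mk⇔ (λ _ → a) (λ _ → refl)
does⇔ (no ¬a) = mk⇔ (λ ()) (λ a → ⊥-elim (¬a a))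

does-cong : ∀ {A B : Set} (a? : Dec A) (b? : Dec B) → (A → B) → (B → A) → does a? ≡ does b?
does-cong (yes _) (yes _) _ _ = refl
does-cong (no _) (no _) _ _ = refl
does-cong (yes a) (no ¬b) a→b _ = ⊥-elim (¬b (a→b a))
does-cong (no ¬a) (yes b) _ b→a = ⊥-elim (¬a (b→a b))

module _ {n : ℕ} where

  -- Paths of FB_n as an inductive family: `Path v p q` is p --v--> q, and
  -- `PathF v p q` is p --v-->_F q, the constructor `visit` marking the
  -- moment the path is in s_f.
  data Path : Word n → State n → State n → Set where
    stay : ∀ {p} → Path [] p p
    move : ∀ {a v p r q} → a p r ≡ true → Path v r q → Path (a ∷ v) p q

  data PathF : Word n → State n → State n → Set where
    visit : ∀ {v q} → Path v sf q → PathF v sf q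
    moveF : ∀ {a v p r q} → a p r ≡ true → PathF v r q → PathF (a ∷ v) p q

  private
    _◃_ : ∀ {l} → State n → (Fin (suc l) → State n) → Fin (suc (suc l)) → State n
    (p ◃ ρ) zero = p
    (p ◃ ρ) (suc i) = ρ i

  run→Path : ∀ v {p q} → p ⟶[ v ] q → Path v p q
  run→Path [] (ρ , refl , refl , _) = stay
  run→Path (a ∷ v) (ρ , refl , end , steps) =
    move (steps zero) (run→Path v (ρ ∘ suc , refl , end , steps ∘ suc))

  Path→run : ∀ {v p q} → Path v p q → p ⟶[ v ] q
  Path→run {p = p} stay = (λ _ → p) , refl , refl , λ ()
  Path→run {p = p} (move e π) with Path→run π
  ... | ρ , refl , end , steps =
    p ◃ ρ , refl , end , λ { zero → e ; (suc i) → steps i }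

  runF→PathF : ∀ v {p q} → p ⟶F[ v ] q → PathF v p q
  runF→PathF v (ρ , run@(refl , _) , zero , atF) =
    subst (λ x → PathF v x _) (sym atF)
      (visit (subst (λ x → Path v x _) atF (run→Path v (ρ , run))))
  runF→PathF (a ∷ v) (ρ , (refl , end , steps) , suc i , atF) =
    moveF (steps zero) (runF→PathF v (ρ ∘ suc , (refl , end , steps ∘ suc) , i , atF))

  PathF→runF : ∀ {v p q} → PathF v p q → p ⟶F[ v ] q
  PathF→runF (visit π) with Path→run π
  ... | ρ , run@(start , _) = ρ , run , zero , start
  PathF→runF {p = p} (moveF e π) with PathF→runF π
  ... | ρ , (refl , end , steps) , i , atF =
    p ◃ ρ , (refl , end , λ { zero → e ; (suc i) → steps i }) , suc i , atF

  ⟶⇔Path : ∀ {v p q} → (p ⟶[ v ] q) ⇔ Path v p q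
  ⟶⇔Path {v} = mk⇔ (run→Path v) Path→run

  ⟶F⇔PathF : ∀ {v p q} → (p ⟶F[ v ] q) ⇔ PathF v p q
  ⟶F⇔PathF {v} = mk⇔ (runF→PathF v) PathF→runF

  join : ∀ {u v p r q} → Path u p r → Path v r q → Path (u ++ v) p q
  join stay π = π
  join (move e π) π' = move e (join π π')

  split : ∀ u {v p q} → Path (u ++ v) p q → ∃[ r ] Path u p r × Path v r q
  split [] π = _ , stay , π
  split (a ∷ u) (move e π) with split u π
  ... | r , π₁ , π₂ = r , move e π₁ , π₂

  VisitIn : Word n → Word n → State n → State n → State n → Set
  VisitIn u v p r q = (PathF u p r × Path v r q) ⊎ (Path u p r × PathF v r q)

  joinF : ∀ {u v p r q} → VisitIn u v p r q → PathF (u ++ v) p q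
  joinF (inj₁ (visit π , π')) = visit (join π π')
  joinF (inj₁ (moveF e π , π')) = moveF e (joinF (inj₁ (π , π')))
  joinF (inj₂ (stay , π')) = π'
  joinF (inj₂ (move e π , π')) = moveF e (joinF (inj₂ (π , π')))

  splitF : ∀ u {v p q} → PathF (u ++ v) p q → ∃[ r ] VisitIn u v p r q
  splitF [] π = _ , inj₂ (stay , π)
  splitF (a ∷ u) (visit π) with split (a ∷ u) π
  ... | r , π₁ , π₂ = r , inj₁ (visit π₁ , π₂)
  splitF (a ∷ u) (moveF e π) with splitF u π
  ... | r , inj₁ (π₁ , π₂) = r , inj₁ (moveF e π₁ , π₂)
  ... | r , inj₂ (π₁ , π₂) = r , inj₂ (move e π₁ , π₂)

  forget : ∀ {v p q} → PathF v p q → Path v p q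
  forget (visit π) = π
  forget (moveF e π) = move e (forget π)

  visit-end : ∀ {v p} → Path v p sf → PathF v p sf
  visit-end stay = visit stay
  visit-end (move e π) = moveF e (visit-end π)

  single : ∀ {a p q} → a p q ≡ true → Path [ a ] p q
  single e = move e stay

  single⁻ : ∀ {a p q} → Path [ a ] p q → a p q ≡ true
  single⁻ (move e stay) = e

  singleF : ∀ {a p q} → a p q ≡ true → p ≡ sf ⊎ q ≡ sf → PathF [ a ] p q
  singleF e (inj₁ refl) = visit (single e)
  singleF e (inj₂ refl) = moveF e (visit stay)

  singleF⁻ : ∀ {a p q} → PathF [ a ] p q → a p q ≡ true × (p ≡ sf ⊎ q ≡ sf)
  singleF⁻ (visit π) = single⁻ π , inj₁ refl
  singleF⁻ (moveF e (visit stay)) = e , inj₂ refl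

  -- Path equivalence: the same paths and F-paths between all states.
  -- Unlike ≈ it is a congruence for concatenation without side conditions.
  _≃_ : Word n → Word n → Set
  u ≃ v = ∀ p q → (Path u p q ⇔ Path v p q) × (PathF u p q ⇔ PathF v p q)

  ≃-refl : ∀ {u} → u ≃ u
  ≃-refl p q = ⇔-id _ , ⇔-id _

  ≃-sym : ∀ {u v} → u ≃ v → v ≃ u
  ≃-sym e p q = ⇔-sym (proj₁ (e p q)) , ⇔-sym (proj₂ (e p q))

  ≃-++ : ∀ {u u' v v'} → u ≃ u' → v ≃ v' → (u ++ v) ≃ (u' ++ v')
  ≃-++ eu ev p q = mk⇔ (along eu ev) (along (≃-sym eu) (≃-sym ev))
                  , mk⇔ (alongF eu ev) (alongF (≃-sym eu) (≃-sym ev))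
    where
    along : ∀ {u u' v v'} → u ≃ u' → v ≃ v' → Path (u ++ v) p q → Path (u' ++ v') p q
    along {u} eu ev π with split u π
    ... | r , π₁ , π₂ = join (to (proj₁ (eu p r)) π₁) (to (proj₁ (ev r q)) π₂)
    alongF : ∀ {u u' v v'} → u ≃ u' → v ≃ v' → PathF (u ++ v) p q → PathF (u' ++ v') p q
    alongF {u} eu ev π with splitF u π
    ... | r , inj₁ (π₁ , π₂) = joinF (inj₁ (to (proj₂ (eu p r)) π₁ , to (proj₁ (ev r q)) π₂))
    ... | r , inj₂ (π₁ , π₂) = joinF (inj₂ (to (proj₁ (eu p r)) π₁ , to (proj₂ (ev r q)) π₂))

  ≃-letter : ∀ {a b} → (∀ p q → a p q ≡ b p q) → [ a ] ≃ [ b ]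
  ≃-letter a≗b p q = mk⇔ (transfer a≗b) (transfer (λ p q → sym (a≗b p q)))
                    , mk⇔ (transferF a≗b) (transferF (λ p q → sym (a≗b p q)))
    where
    transfer : ∀ {a b} → (∀ p q → a p q ≡ b p q) → Path [ a ] p q → Path [ b ] p q
    transfer a≗b π = single (trans (sym (a≗b p q)) (single⁻ π))
    transferF : ∀ {a b} → (∀ p q → a p q ≡ b p q) → PathF [ a ] p q → PathF [ b ] p q
    transferF a≗b π with singleF⁻ π
    ... | e , where-sf = singleF (trans (sym (a≗b p q)) e) where-sf

  _ᵀ : Letter n → Letter n
  (a ᵀ) p q = a q p

  converse : Word n → Word n
  converse [] = []
  converse (a ∷ v) = converse v ++ [ a ᵀ ]

  converse-path : ∀ v {p q} → Path (converse v) p q ⇔ Path v q p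
  converse-path v = mk⇔ (forward v) (backward v)
    where
    forward : ∀ v {p q} → Path (converse v) p q → Path v q p
    forward [] stay = stay
    forward (a ∷ v) π with split (converse v) π
    ... | r , π₁ , π₂ = move (single⁻ π₂) (forward v π₁)
    backward : ∀ v {p q} → Path v q p → Path (converse v) p q
    backward [] stay = stay
    backward (a ∷ v) (move e π) = join (backward v π) (single e)

  converse-pathF : ∀ v {p q} → PathF (converse v) p q ⇔ PathF v q p
  converse-pathF v = mk⇔ (forward v) (backward v)
    where
    forward : ∀ v {p q} → PathF (converse v) p q → PathF v q p
    forward [] (visit stay) = visit stay
    forward (a ∷ v) π with splitF (converse v) π
    ... | r , inj₁ (π₁ , π₂) = moveF (single⁻ π₂) (forward v π₁)
    ... | r , inj₂ (π₁ , π₂) with singleF⁻ π₂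
    ...   | e , inj₁ refl = moveF e (visit (to (converse-path v) π₁))
    ...   | e , inj₂ refl = visit (move e (to (converse-path v) π₁))
    backward : ∀ v {p q} → PathF v q p → PathF (converse v) p q
    backward [] (visit stay) = visit stay
    backward (a ∷ v) (visit (move e π)) =
      joinF (inj₂ (from (converse-path v) π , singleF e (inj₂ refl)))
    backward (a ∷ v) (moveF e π) = joinF (inj₁ (backward v π , single e))


  Separated : Letter n → Set
  Separated a = (∀ i → a (s i) sf ≡ false) × (∀ j → a sf (s j) ≡ false)

  Trapping : Letter n → Set
  Trapping a = ∀ j → a sf (s j) ≡ false

  trapped : ∀ {v q} → All Trapping v → Path v sf q → q ≡ sf
  trapped _ stay = refl
  trapped (_ ∷ ts) (move {r = sf} _ π) = trapped ts π
  trapped (t ∷ _) (move {r = s j} e _) = ⊥-elim (true≠false e (t j))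

  trappedF : ∀ {v p q} → All Trapping v → PathF v p q → q ≡ sf
  trappedF ts (visit π) = trapped ts π
  trappedF (_ ∷ ts) (moveF _ π) = trappedF ts π

  never-leaves : ∀ {v j} → All Separated v → ¬ Path v sf (s j)
  never-leaves seps π with trapped (All.map proj₂ seps) π
  ... | ()

  never-visits : ∀ {v i q} → All Separated v → ¬ PathF v (s i) q
  never-visits (_ ∷ seps) (moveF {r = s j} _ π) = never-visits seps π
  never-visits ((out , _) ∷ _) (moveF {r = sf} e _) = true≠false e (out _)

  -- Agreement: the same paths and F-paths between states of S'_n, which is
  -- all that ≈ observes.
  Agree : Word n → Word n → Set
  Agree u v = ∀ p q → (Path u (s p) (s q) ⇔ Path v (s p) (s q))
                    × (PathF u (s p) (s q) ⇔ PathF v (s p) (s q))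

  Agree-refl : ∀ {u} → Agree u u
  Agree-refl p q = ⇔-id _ , ⇔-id _

  Agree-sym : ∀ {u v} → Agree u v → Agree v u
  Agree-sym e p q = ⇔-sym (proj₁ (e p q)) , ⇔-sym (proj₂ (e p q))

  Agree⇒≈ : ∀ {u v} → Agree u v → u ≈ v
  Agree⇒≈ e p q = ⇔-sym ⟶⇔Path ⇔-∘ (proj₁ (e p q) ⇔-∘ ⟶⇔Path)
                , ⇔-sym ⟶F⇔PathF ⇔-∘ (proj₂ (e p q) ⇔-∘ ⟶F⇔PathF)

  -- Agreement is a
  -- congruence for concatenation with a closed left factor, since then every
  -- path from S'_n passes the junction inside S'_n.
  Closed : Word n → Set
  Closed u = ∀ {p} → ¬ Path u (s p) sf

  Closed-++ : ∀ {u v} → Closed u → Closed v → Closed (u ++ v)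
  Closed-++ {u} cu cv π with split u π
  ... | s r , _ , π₂ = cv π₂
  ... | sf , π₁ , _ = cu π₁

  Agree-++ : ∀ {u u' v v'} → Closed u → Closed u' → Agree u u' → Agree v v' →
             Agree (u ++ v) (u' ++ v')
  Agree-++ cu cu' eu ev p q = mk⇔ (along cu eu ev) (along cu' (Agree-sym eu) (Agree-sym ev))
                            , mk⇔ (alongF cu eu ev) (alongF cu' (Agree-sym eu) (Agree-sym ev))
    where
    along : ∀ {u u' v v'} → Closed u → Agree u u' → Agree v v' →
            Path (u ++ v) (s p) (s q) → Path (u' ++ v') (s p) (s q)
    along {u} cu eu ev π with split u π
    ... | sf , π₁ , _ = ⊥-elim (cu π₁)
    ... | s r , π₁ , π₂ = join (to (proj₁ (eu p r)) π₁) (to (proj₁ (ev r q)) π₂)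
    alongF : ∀ {u u' v v'} → Closed u → Agree u u' → Agree v v' →
             PathF (u ++ v) (s p) (s q) → PathF (u' ++ v') (s p) (s q)
    alongF {u} cu eu ev π with splitF u π
    ... | sf , inj₁ (π₁ , _) = ⊥-elim (cu (forget π₁))
    ... | sf , inj₂ (π₁ , _) = ⊥-elim (cu π₁)
    ... | s r , inj₁ (π₁ , π₂) = joinF (inj₁ (to (proj₂ (eu p r)) π₁ , to (proj₁ (ev r q)) π₂))
    ... | s r , inj₂ (π₁ , π₂) = joinF (inj₂ (to (proj₁ (eu p r)) π₁ , to (proj₂ (ev r q)) π₂))

  Realizes : Word n → (S' n → S' n → Set) → (S' n → S' n → Set) → Set
  Realizes u R RF = ∀ p q → (Path u (s p) (s q) ⇔ R p q) × (PathF u (s p) (s q) ⇔ RF p q)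

  realizes-agree : ∀ {u v R R' RF RF'} → Realizes u R RF → Realizes v R' RF' →
                   (∀ p q → R p q ⇔ R' p q) → (∀ p q → RF p q ⇔ RF' p q) → Agree u v
  realizes-agree ru rv eR eRF p q =
      ⇔-sym (proj₁ (rv p q)) ⇔-∘ (eR p q ⇔-∘ proj₁ (ru p q))
    , ⇔-sym (proj₂ (rv p q)) ⇔-∘ (eRF p q ⇔-∘ proj₂ (ru p q))

-- The words w_{f,g}.  A block d(h,r,r') lets a state of rank r jump through
-- s_f to a state of rank r', and otherwise stays put; c(f,g) relates states
-- of equal odd rank.
Jump : (n : ℕ) → (S' n → ℕ) → ℕ → ℕ → S' n → S' n → Set
Jump n h r r' p q = h p ≡ r × h q ≡ r'

SameOddRank : (n : ℕ) → (S' n → ℕ) → (S' n → ℕ) → S' n → S' n → Set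
SameOddRank n f g p q = f p ≡ g q × f p % 2 ≡ 1

module _ {n : ℕ} (h : S' n → ℕ) (r r' : ℕ) where

  private
    d-path : ∀ {p y} → Path (d n h r r') (s p) y → ∃[ q ] y ≡ s q × (p ≡ q ⊎ Jump n h r r' p q)
    d-path {p} (move {r = s p'} e₁ (move {r = s q} e₂ stay)) =
      q , refl , inj₁ (trans (to (does⇔ (p Fin.≟ p')) e₁) (to (does⇔ (p' Fin.≟ q)) e₂))
    d-path (move {r = s _} _ (move {r = sf} () stay))
    d-path {p} (move {r = sf} e₁ (move {r = s q} e₂ stay)) =
      q , refl , inj₂ (to (does⇔ (h p ≟ r)) e₁ , to (does⇔ (h q ≟ r')) e₂)
    d-path (move {r = sf} _ (move {r = sf} () stay))

    d-pathF : ∀ {p q} → PathF (d n h r r') (s p) (s q) → Jump n h r r' p q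
    d-pathF {p} {q} (moveF {r = sf} e₁ (visit (move e₂ stay))) =
      to (does⇔ (h p ≟ r)) e₁ , to (does⇔ (h q ≟ r')) e₂
    d-pathF (moveF {r = sf} _ (moveF {r = s _} _ ()))
    d-pathF (moveF {r = sf} _ (moveF {r = sf} () _))
    d-pathF (moveF {r = s _} _ (moveF {r = s _} _ ()))
    d-pathF (moveF {r = s _} _ (moveF {r = sf} () _))

    d-stay : ∀ {p} → Path (d n h r r') (s p) (s p)
    d-stay {p} = move {r = s p} (from (does⇔ (p Fin.≟ p)) refl) (single (from (does⇔ (p Fin.≟ p)) refl))

    d-jump : ∀ {p q} → Jump n h r r' p q → PathF (d n h r r') (s p) (s q)
    d-jump {p} {q} (hp , hq) =
      moveF (from (does⇔ (h p ≟ r)) hp) (visit (single (from (does⇔ (h q ≟ r')) hq)))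

  d-closed : Closed (d n h r r')
  d-closed π with d-path π
  ... | _ , () , _

  d-realizes : Realizes (d n h r r') (λ p q → p ≡ q ⊎ Jump n h r r' p q) (Jump n h r r')
  d-realizes p q = mk⇔ described describe , mk⇔ d-pathF d-jump
    where
    described : Path (d n h r r') (s p) (s q) → p ≡ q ⊎ Jump n h r r' p q
    described π with d-path π
    ... | _ , refl , pq = pq
    describe : p ≡ q ⊎ Jump n h r r' p q → Path (d n h r r') (s p) (s q)
    describe (inj₁ refl) = d-stay
    describe (inj₂ j) = forget (d-jump j)

module _ {n : ℕ} (f g : S' n → ℕ) where

  c-closed : Closed [ c n f g ]
  c-closed (move () stay)

  c-realizes : Realizes [ c n f g ] (SameOddRank n f g) (λ _ _ → ⊥)
  c-realizes p q = mk⇔ described describe , mk⇔ noVisit λ ()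
    where
    described : Path [ c n f g ] (s p) (s q) → SameOddRank n f g p q
    described π = to (does⇔ (f p ≟ g q)) (∧-conicalˡ _ _ (single⁻ π))
                , to (does⇔ (f p % 2 ≟ 1)) (∧-conicalʳ _ _ (single⁻ π))
    describe : SameOddRank n f g p q → Path [ c n f g ] (s p) (s q)
    describe (same , odd) = single (both (from (does⇔ (f p ≟ g q)) same) (from (does⇔ (f p % 2 ≟ 1)) odd))
      where
      both : ∀ {x y} → x ≡ true → y ≡ true → x ∧ y ≡ true
      both refl refl = refl
    noVisit : ¬ PathF [ c n f g ] (s p) (s q)
    noVisit (moveF {r = s _} _ ())
    noVisit (moveF {r = sf} () _)

chain : {A : Set} → (ℕ → ℕ → List A) → List ℕ → List A
chain b (r ∷ r' ∷ rs) = b r r' ++ chain b (r' ∷ rs)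
chain b _ = []

u-chain : ∀ {n} (h : S' n → ℕ) → u n h ≡ chain (d n h) (valuesDesc n h)
u-chain {n} h = go (valuesDesc n h)
  where
  go : ∀ rs → uFrom n h rs ≡ chain (d n h) rs
  go [] = refl
  go (r ∷ []) = refl
  go (r ∷ r' ∷ rs) = cong (d n h r r' ++_) (go (r' ∷ rs))

map-chain : ∀ {A B : Set} (f : A → B) b rs → map f (chain b rs) ≡ chain (λ r r' → map f (b r r')) rs
map-chain f b [] = refl
map-chain f b (r ∷ []) = refl
map-chain f b (r ∷ r' ∷ rs) =
  trans (map-++ f (b r r') (chain b (r' ∷ rs))) (cong (map f (b r r') ++_) (map-chain f b (r' ∷ rs)))

valuesDesc-decreasing : ∀ {n} (h : S' n → ℕ) → Linked _>_ (valuesDesc n h)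
valuesDesc-decreasing h =
  filter⁺ (λ r → Fin.any? (λ q → h q ≟ r)) (λ x>y y>z → <-trans y>z x>y) (applyDownFrom⁺₂ _ _ n<1+n)

module _ {n : ℕ} where

  chain-closed : ∀ {b : ℕ → ℕ → Word n} → (∀ r r' → Closed (b r r')) → ∀ rs → Closed (chain b rs)
  chain-closed cb [] ()
  chain-closed cb (r ∷ []) ()
  chain-closed cb (r ∷ r' ∷ rs) = Closed-++ (cb r r') (chain-closed cb (r' ∷ rs))

  chain-agree : ∀ {R : ℕ → ℕ → Set} {b b' : ℕ → ℕ → Word n} {rs} → Linked R rs →
                (∀ r r' → Closed (b r r')) → (∀ r r' → Closed (b' r r')) →
                (∀ {r r'} → R r r' → Agree (b r r') (b' r r')) → Agree (chain b rs) (chain b' rs)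
  chain-agree [] _ _ _ = Agree-refl
  chain-agree [-] _ _ _ = Agree-refl
  chain-agree {rs = r ∷ r' ∷ rs} (rel ∷ lnk) cb cb' agree =
    Agree-++ (cb r r') (cb' r r') (agree rel) (chain-agree lnk cb cb' agree)

u-closed : ∀ {n} (h : S' n → ℕ) → Closed (u n h)
u-closed {n} h = subst Closed (sym (u-chain h)) (chain-closed (d-closed h) (valuesDesc n h))

chain-[] : ∀ {A : Set} rs → chain {A} (λ _ _ → []) rs ≡ []
chain-[] [] = refl
chain-[] (r ∷ []) = refl
chain-[] (r ∷ r' ∷ rs) = chain-[] (r' ∷ rs)

[]-realizes : ∀ {n} → Realizes {n} [] _≡_ (λ _ _ → ⊥)
[]-realizes p q = mk⇔ (λ { stay → refl }) (λ { refl → stay }) , mk⇔ (λ ()) (λ ())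

signature : ∀ {n} → List (State n × State n) → Letter n → List Bool
signature probes a = map (λ pq → a (proj₁ pq) (proj₂ pq)) probes

distinct-by-signature : ∀ {n k} (Γ : Fin k → Letter n) (probes : List (State n × State n))
  (decode : List Bool → Fin k) → (∀ i → decode (signature probes (Γ i)) ≡ i) →
  ∀ i j → i ≢ j → ¬ (∀ p q → Γ i p q ≡ Γ j p q)
distinct-by-signature Γ probes decode decodes i j i≢j same =
  i≢j (trans (sym (decodes i))
        (trans (cong decode (map-cong (λ pq → same (proj₁ pq) (proj₂ pq)) probes)) (decodes j)))

-- The case n = 2: S'_2 = {s_0}.  Each u_h is then path-trivial, since its
-- blocks join distinct values of h, and w_{f,g} agrees with the single
-- letter ι relating s_0 to itself.
module TwoStates where

  letter : Bool → Bool → Bool → Bool → Letter 2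
  letter ss _ _ _ (s _) (s _) = ss
  letter _ sF _ _ (s _) sf = sF
  letter _ _ Fs _ sf (s _) = Fs
  letter _ _ _ FF sf sf = FF

  Γ : Fin 7 → Letter 2
  Γ zero = letter true false false false
  Γ (suc zero) = letter false true false false
  Γ (suc (suc zero)) = letter false false true false
  Γ (suc (suc (suc zero))) = letter false false false true
  Γ (suc (suc (suc (suc zero)))) = letter false false false false
  Γ (suc (suc (suc (suc (suc zero))))) = letter true true true true
  Γ (suc (suc (suc (suc (suc (suc zero)))))) = letter true false false true

  probes : List (State 2 × State 2)
  probes = (s zero , s zero) ∷ (s zero , sf) ∷ (sf , s zero) ∷ (sf , sf) ∷ []

  decode : List Bool → Fin 7
  decode (false ∷ true ∷ false ∷ false ∷ []) = suc zero
  decode (false ∷ false ∷ true ∷ false ∷ []) = suc (suc zero)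
  decode (false ∷ false ∷ false ∷ true ∷ []) = suc (suc (suc zero))
  decode (false ∷ false ∷ false ∷ false ∷ []) = suc (suc (suc (suc zero)))
  decode (true ∷ true ∷ true ∷ true ∷ []) = suc (suc (suc (suc (suc zero))))
  decode (true ∷ false ∷ false ∷ true ∷ []) = suc (suc (suc (suc (suc (suc zero)))))
  decode _ = zero

  Γ-distinct : ∀ i j → i ≢ j → ¬ (∀ p q → Γ i p q ≡ Γ j p q)
  Γ-distinct = distinct-by-signature Γ probes decode λ
    { zero → refl ; (suc zero) → refl ; (suc (suc zero)) → refl ; (suc (suc (suc zero))) → refl
    ; (suc (suc (suc (suc zero)))) → refl ; (suc (suc (suc (suc (suc zero))))) → refl
    ; (suc (suc (suc (suc (suc (suc zero)))))) → refl }

  ι : Letter 2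
  ι = Γ zero

-- Consecutive values r > r' of h cannot both be attained at s_0, so each
-- block of u_h only stays in place.
  u-trivial : ∀ h → Agree (u 2 h) []
  u-trivial h = subst₂ Agree (sym (u-chain h)) (chain-[] (valuesDesc 2 h))
    (chain-agree {b = d 2 h} {b' = λ _ _ → []} (valuesDesc-decreasing {2} h) (d-closed h) (λ _ _ ()) block-trivial)
    where
    block-trivial : ∀ {r r'} → r > r' → Agree (d 2 h r r') []
    block-trivial {r} {r'} r>r' = realizes-agree (d-realizes h r r') []-realizes
      (λ { zero zero → mk⇔ (λ _ → refl) inj₁ })
      (λ { zero zero → mk⇔ (λ { (hr , hr') → <-irrefl (trans (sym hr') hr) r>r' }) λ () })

-- f(s_0) = g(s_0) = 1, so c(f,g) relates s_0 to itself, like ι.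
  w-agrees : ∀ m → 1 ≤ m → ∀ f g → IsQRanking 2 m f → IsQRanking 2 m g → Agree (w 2 f g) [ ι ]
  w-agrees m 1≤m f g rf rg =
    Agree-++ (u-closed f) (λ ()) (u-trivial f)
      (Agree-++ (c-closed f g) (λ { (move () stay) })
        (realizes-agree (c-realizes f g) ι-realizes (λ { zero zero → mk⇔ (λ _ → tt) (λ _ → level-one) })
          (λ _ _ → mk⇔ (λ ()) (λ ())))
        (u-trivial g))
    where
    ι-realizes : Realizes [ ι ] (λ _ _ → ⊤) (λ _ _ → ⊥)
    ι-realizes p q = mk⇔ (λ _ → tt) (λ _ → single refl)
                   , mk⇔ (λ { (moveF {r = s _} _ ()) ; (moveF {r = sf} () _) }) λ ()
    rank-one : ∀ h → IsQRanking 2 m h → h zero ≡ 1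
    rank-one h rk with proj₂ rk 0 1≤m
    ... | zero , e = e
    level-one : SameOddRank 2 f g zero zero
    level-one = trans (rank-one f rf) (sym (rank-one g rg)) , cong (_% 2) (rank-one f rf)

_^[_] : {A : Set} → (A → A) → ℕ → A → A
(f ^[ zero ]) x = x
(f ^[ suc a ]) x = (f ^[ a ]) (f x)

module _ {A : Set} (f : A → A) where

  ^-+ : ∀ a b x → (f ^[ a + b ]) x ≡ (f ^[ b ]) ((f ^[ a ]) x)
  ^-+ zero b x = refl
  ^-+ (suc a) b x = ^-+ a b (f x)

  ^-fixed : ∀ {x} → f x ≡ x → ∀ a → (f ^[ a ]) x ≡ x
  ^-fixed fx zero = refl
  ^-fixed fx (suc a) = trans (cong (f ^[ a ]) fx) (^-fixed fx a)

  ^-intertwine : ∀ {B : Set} {g : B → B} (φ : B → A) → (∀ x → f (φ x) ≡ φ (g x)) →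
                 ∀ a x → (f ^[ a ]) (φ x) ≡ φ ((g ^[ a ]) x)
  ^-intertwine φ comm zero x = refl
  ^-intertwine φ comm (suc a) x = trans (cong (f ^[ a ]) (comm x)) (^-intertwine φ comm a _)

rot : ∀ {M} → Fin (suc M) → Fin (suc M)
rot {M} zero = fromℕ M
rot (suc i) = inject₁ i

module _ {M : ℕ} where

  toℕ-rot^ : ∀ a (i : Fin (suc M)) → a ≤ toℕ i → toℕ ((rot ^[ a ]) i) ≡ toℕ i ∸ a
  toℕ-rot^ zero i _ = refl
  toℕ-rot^ (suc a) (suc i) (s≤s a≤i) =
    trans (toℕ-rot^ a (inject₁ i) (subst (a ≤_) (sym (toℕ-inject₁ i)) a≤i)) (cong (_∸ a) (toℕ-inject₁ i))

  rot^-self : ∀ (i : Fin (suc M)) → (rot ^[ toℕ i ]) i ≡ zero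
  rot^-self i = toℕ-injective (trans (toℕ-rot^ (toℕ i) i ≤-refl) (n∸n≡0 (toℕ i)))

  rot^-period : ∀ (i : Fin (suc M)) → (rot ^[ suc M ]) i ≡ i
  rot^-period i = begin
    (rot ^[ suc M ]) i                        ≡⟨ cong (λ a → (rot ^[ a ]) i) split-period ⟩
    (rot ^[ toℕ i + suc (M ∸ toℕ i) ]) i      ≡⟨ ^-+ rot (toℕ i) (suc (M ∸ toℕ i)) i ⟩
    (rot ^[ suc (M ∸ toℕ i) ]) ((rot ^[ toℕ i ]) i) ≡⟨ cong (rot ^[ suc (M ∸ toℕ i) ]) (rot^-self i) ⟩
    (rot ^[ M ∸ toℕ i ]) (fromℕ M)            ≡⟨ toℕ-injective back-at-i ⟩
    i                                         ∎
    where
    open ≡-Reasoning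
    i≤M : toℕ i ≤ M
    i≤M = ≤-pred (toℕ<n i)
    split-period : suc M ≡ toℕ i + suc (M ∸ toℕ i)
    split-period = trans (cong suc (sym (m+[n∸m]≡n i≤M))) (sym (+-suc (toℕ i) (M ∸ toℕ i)))
    back-at-i : toℕ ((rot ^[ M ∸ toℕ i ]) (fromℕ M)) ≡ toℕ i
    back-at-i = trans (toℕ-rot^ (M ∸ toℕ i) (fromℕ M) (subst (M ∸ toℕ i ≤_) (sym (toℕ-fromℕ M)) (m∸n≤m M (toℕ i))))
                      (trans (cong (_∸ (M ∸ toℕ i)) (toℕ-fromℕ M)) (m∸[m∸n]≡n i≤M))

  rot^-cancel : ∀ a (i : Fin (suc M)) → a ≤ suc M → (rot ^[ suc M ∸ a ]) ((rot ^[ a ]) i) ≡ i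
  rot^-cancel a i a≤ = trans (sym (^-+ rot a (suc M ∸ a) i))
                             (trans (cong (λ b → (rot ^[ b ]) i) (m+[n∸m]≡n a≤)) (rot^-period i))

  rot^-injective : ∀ a {i j : Fin (suc M)} → a ≤ suc M → (rot ^[ a ]) i ≡ (rot ^[ a ]) j → i ≡ j
  rot^-injective a {i} {j} a≤ e =
    trans (sym (rot^-cancel a i a≤)) (trans (cong (rot ^[ suc M ∸ a ]) e) (rot^-cancel a j a≤))

  rot-rot^M : ∀ (i : Fin (suc M)) → rot ((rot ^[ M ]) i) ≡ i
  rot-rot^M i = trans (sym (^-+ rot M 1 i)) (trans (cong (λ b → (rot ^[ b ]) i) (+-comm M 1)) (rot^-period i))

odd-decomposition : ∀ x → x % 2 ≡ 1 → x ≡ suc (x / 2 * 2)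
odd-decomposition x odd = trans (m≡m%n+[m/n]*n x 2) (cong (_+ x / 2 * 2) odd)

odd-parity : ∀ t → suc (2 * t) % 2 ≡ 1
odd-parity t = trans (cong (λ x → suc x % 2) (*-comm 2 t)) ([m+kn]%n≡m%n 1 t 2)

odd-half : ∀ t → suc (2 * t) / 2 ≡ t
odd-half t = *-cancelʳ-≡ (suc (2 * t) / 2) t 2
  (sym (suc-injective (trans (cong suc (*-comm t 2)) (odd-decomposition (suc (2 * t)) (odd-parity t)))))

-- The level of a Q(m)-ranking h: a state q of odd rank 2j + 1 has level
-- j ∈ Fin m, states of even rank have none.  Every level is attained.
module Levels {n m : ℕ} (h : S' n → ℕ) (rk : IsQRanking n m h) where

  private
    half<m : ∀ q → h q / 2 < m
    half<m q = m<n*o⇒m/o<n (subst (h q <_) (*-comm 2 m) (proj₁ rk q))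

    level-at : ∀ q → Dec (h q % 2 ≡ 1) → Maybe (Fin m)
    level-at q (yes _) = just (fromℕ< (half<m q))
    level-at q (no _) = nothing

  level : S' n → Maybe (Fin m)
  level q = level-at q (h q % 2 ≟ 1)

  level⇔ : ∀ q j → level q ≡ just j ⇔ (h q % 2 ≡ 1 × toℕ j ≡ h q / 2)
  level⇔ q j = by-cases (h q % 2 ≟ 1)
    where
    by-cases : (odd? : Dec (h q % 2 ≡ 1)) → level-at q odd? ≡ just j ⇔ (h q % 2 ≡ 1 × toℕ j ≡ h q / 2)
    by-cases (yes odd) = mk⇔ (λ { refl → odd , toℕ-fromℕ< (half<m q) })
                             (λ (_ , j≡) → cong just (toℕ-injective (trans (toℕ-fromℕ< (half<m q)) (sym j≡))))
    by-cases (no even) = mk⇔ (λ ()) (λ (odd , _) → ⊥-elim (even odd))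

  level-odd : ∀ q → h q % 2 ≡ 1 → ∃[ j ] level q ≡ just j × toℕ j ≡ h q / 2
  level-odd q odd = fromℕ< (half<m q) , from (level⇔ q _) (odd , toℕ-fromℕ< (half<m q)) , toℕ-fromℕ< (half<m q)

  rep : Fin m → S' n
  rep j = proj₁ (proj₂ rk (toℕ j) (toℕ<n j))

  level-rep : ∀ j → level (rep j) ≡ just j
  level-rep j = from (level⇔ (rep j) j)
    (trans (cong (_% 2) rank) (odd-parity (toℕ j)) , sym (trans (cong (_/ 2) rank) (odd-half (toℕ j))))
    where
    rank : h (rep j) ≡ suc (2 * toℕ j)
    rank = proj₂ (proj₂ rk (toℕ j) (toℕ<n j))

module _ {n m : ℕ} (f g : S' n → ℕ) (rf : IsQRanking n m f) (rg : IsQRanking n m g) where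

  private
    module F = Levels {n} f rf
    module G = Levels {n} g rg

  same-level : ∀ p q → SameOddRank n f g p q ⇔ (∃[ j ] F.level p ≡ just j × G.level q ≡ just j)
  same-level p q = mk⇔ forward backward
    where
    forward : SameOddRank n f g p q → ∃[ j ] F.level p ≡ just j × G.level q ≡ just j
    forward (same , odd) with F.level-odd p odd
    ... | j , fp , j≡ = j , fp , from (G.level⇔ q j) (subst (λ x → x % 2 ≡ 1) same odd , trans j≡ (cong (_/ 2) same))
    backward : (∃[ j ] F.level p ≡ just j × G.level q ≡ just j) → SameOddRank n f g p q
    backward (j , fp , gq) with to (F.level⇔ p j) fp | to (G.level⇔ q j) gq
    ... | odd-f , j≡f | odd-g , j≡g =
      trans (odd-decomposition (f p) odd-f)
            (trans (cong (λ x → suc (x * 2)) (trans (sym j≡f) j≡g)) (sym (odd-decomposition (g q) odd-g)))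
      , odd-f

-- The case n = k + 3, with N = k + 2 cells S'_n.  The seven letters:
--   ρ  rotates the cells (and keeps s_f),      τ  swaps cells 0 and 1,
--   μ  merges cell 1 into cell 0,             μᵀ its transpose,
--   κ  deletes cell 0,                        ξ  also lets cell 0 exit to s_f,
--   ξᵀ (the transpose of ξ) lets s_f enter cell 0.
-- ρ, τ, μ, κ are graphs of partial maps of the cells; the set is closed
-- under converse up to path equivalence (ρᵀ ≃ ρ^(N-1)).
module Generators (k : ℕ) where

  N : ℕ
  N = suc (suc k)

  Cell : Set
  Cell = Fin N

  toℕ≤N : ∀ (i : Cell) → toℕ i ≤ N
  toℕ≤N i = <⇒≤ (toℕ<n i)

  swap01 : Cell → Cell
  swap01 zero = suc zero
  swap01 (suc zero) = zero
  swap01 (suc (suc i)) = suc (suc i)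

  merge10 : Cell → Cell
  merge10 zero = zero
  merge10 (suc zero) = zero
  merge10 (suc (suc i)) = suc (suc i)

  kill0 : Cell → Maybe Cell
  kill0 zero = nothing
  kill0 (suc i) = just (suc i)

  graph : Bool → (Cell → Maybe Cell) → Letter (3 + k)
  graph _ φ (s i) (s j) = does (Maybe.≡-dec Fin._≟_ (φ i) (just j))
  graph keep _ sf sf = keep
  graph _ _ (s _) sf = false
  graph _ _ sf (s _) = false

  exit : Letter (3 + k)
  exit (s i) (s j) = does (i Fin.≟ j)
  exit (s zero) sf = true
  exit (s (suc _)) sf = false
  exit sf sf = true
  exit sf (s _) = false

  pattern ρ = zero
  pattern τ = suc zero
  pattern μ = suc (suc zero)
  pattern μᵀ = suc (suc (suc zero))
  pattern κ = suc (suc (suc (suc zero)))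
  pattern ξ = suc (suc (suc (suc (suc zero))))
  pattern ξᵀ = suc (suc (suc (suc (suc (suc zero)))))

  Γ : Fin 7 → Letter (3 + k)
  Γ ρ = graph true (just ∘ rot)
  Γ τ = graph false (just ∘ swap01)
  Γ μ = graph false (just ∘ merge10)
  Γ μᵀ = Γ μ ᵀ
  Γ κ = graph false kill0
  Γ ξ = exit
  Γ ξᵀ = exit ᵀ

  probes : List (State (3 + k) × State (3 + k))
  probes = (s zero , s zero) ∷ (s (suc zero) , s zero) ∷ (s (suc zero) , s (suc zero))
         ∷ (s zero , sf) ∷ (sf , s zero) ∷ (sf , sf) ∷ []

  decode : List Bool → Fin 7
  decode (false ∷ true ∷ false ∷ false ∷ false ∷ false ∷ []) = τ
  decode (true ∷ true ∷ false ∷ false ∷ false ∷ false ∷ []) = μ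
  decode (true ∷ false ∷ false ∷ false ∷ false ∷ false ∷ []) = μᵀ
  decode (false ∷ false ∷ true ∷ false ∷ false ∷ false ∷ []) = κ
  decode (true ∷ false ∷ true ∷ true ∷ false ∷ true ∷ []) = ξ
  decode (true ∷ false ∷ true ∷ false ∷ true ∷ true ∷ []) = ξᵀ
  decode _ = ρ

  Γ-distinct : ∀ i j → i ≢ j → ¬ (∀ p q → Γ i p q ≡ Γ j p q)
  Γ-distinct = distinct-by-signature Γ probes decode λ
    { ρ → refl ; τ → refl ; μ → refl ; μᵀ → refl ; κ → refl ; ξ → refl ; ξᵀ → refl }

  module _ {keep : Bool} {φ : Cell → Maybe Cell} where

    graph-step : ∀ {i y} → graph keep φ (s i) y ≡ true ⇔ (∃[ j ] φ i ≡ just j × y ≡ s j)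
    graph-step {i} {s j} = mk⇔ (λ e → j , to (does⇔ (Maybe.≡-dec Fin._≟_ (φ i) (just j))) e , refl)
                                (λ { (j , e , refl) → from (does⇔ (Maybe.≡-dec Fin._≟_ (φ i) (just j))) e })
    graph-step {y = sf} = mk⇔ (λ ()) (λ { (_ , _ , ()) })

    graph-separated : Separated (graph keep φ)
    graph-separated = (λ _ → refl) , (λ _ → refl)

    graph-symmetric : (∀ {i j} → φ i ≡ just j → φ j ≡ just i) → ∀ p q → graph keep φ p q ≡ graph keep φ q p
    graph-symmetric sym-φ (s i) (s j) =
      does-cong (Maybe.≡-dec Fin._≟_ (φ i) (just j)) (Maybe.≡-dec Fin._≟_ (φ j) (just i)) sym-φ sym-φ
    graph-symmetric _ (s _) sf = refl
    graph-symmetric _ sf (s _) = refl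
    graph-symmetric _ sf sf = refl

  rotate : State (3 + k) → State (3 + k)
  rotate (s i) = s (rot i)
  rotate sf = sf

  rotate^-cell : ∀ a i → (rotate ^[ a ]) (s i) ≡ s ((rot ^[ a ]) i)
  rotate^-cell = ^-intertwine rotate s (λ _ → refl)

  rotate^-sf : ∀ a → (rotate ^[ a ]) sf ≡ sf
  rotate^-sf = ^-fixed rotate refl

  ρ-step : ∀ {p q} → Γ ρ p q ≡ true ⇔ q ≡ rotate p
  ρ-step {s i} {q} = mk⇔ (λ e → case (to ρ-graph e)) (λ { refl → from ρ-graph (rot i , refl , refl) })
    where
    ρ-graph : Γ ρ (s i) q ≡ true ⇔ (∃[ j ] just (rot i) ≡ just j × q ≡ s j)
    ρ-graph = graph-step
    case : (∃[ j ] just (rot i) ≡ just j × q ≡ s j) → q ≡ s (rot i)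
    case (_ , refl , refl) = refl
  ρ-step {sf} {sf} = mk⇔ (λ _ → refl) (λ _ → refl)
  ρ-step {sf} {s _} = mk⇔ (λ ()) (λ ())

  ρs : ℕ → List (Fin 7)
  ρs a = replicate a ρ

  ρs-path : ∀ a {p q} → Path (map Γ (ρs a)) p q ⇔ q ≡ (rotate ^[ a ]) p
  ρs-path a = mk⇔ (forward a) (backward a)
    where
    forward : ∀ a {p q} → Path (map Γ (ρs a)) p q → q ≡ (rotate ^[ a ]) p
    forward zero stay = refl
    forward (suc a) {p} (move {r = r} e π) with to (ρ-step {p} {r}) e
    ... | refl = forward a π
    backward : ∀ a {p q} → q ≡ (rotate ^[ a ]) p → Path (map Γ (ρs a)) p q
    backward zero refl = stay
    backward (suc a) {p} e = move (from (ρ-step {p} {rotate p}) refl) (backward a e)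

  ρs-separated : ∀ a → All Separated (map Γ (ρs a))
  ρs-separated zero = []
  ρs-separated (suc a) = graph-separated {true} {just ∘ rot} ∷ ρs-separated a

  ρs-pathF : ∀ a {p q} → PathF (map Γ (ρs a)) p q ⇔ (p ≡ sf × q ≡ sf)
  ρs-pathF a {p} = mk⇔ (forward p) (λ { (refl , refl) → visit (from (ρs-path a) (sym (rotate^-sf a))) })
    where
    forward : ∀ p {q} → PathF (map Γ (ρs a)) p q → p ≡ sf × q ≡ sf
    forward sf π = refl , trans (to (ρs-path a) (forget π)) (rotate^-sf a)
    forward (s _) π = ⊥-elim (never-visits (ρs-separated a) π)

  ρᵀ≃ρs : map Γ (ρs (suc k)) ≃ [ Γ ρ ᵀ ]
  ρᵀ≃ρs p q = (mk⇔ (λ π → single (from ρ-step (undo p (to (ρs-path (suc k)) π))))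
                   (λ π → from (ρs-path (suc k)) (redo q (to ρ-step (single⁻ π)))))
            , (mk⇔ (λ π → case (to (ρs-pathF (suc k)) π))
                   (λ π → from (ρs-pathF (suc k)) (caseᵀ p q (singleF⁻ π))))
    where
    undo : ∀ p {q} → q ≡ (rotate ^[ suc k ]) p → p ≡ rotate q
    undo (s i) refl = trans (cong s (sym (rot-rot^M i))) (cong rotate (sym (rotate^-cell (suc k) i)))
    undo sf refl = sym (cong rotate (rotate^-sf (suc k)))
    redo : ∀ q {p} → p ≡ rotate q → q ≡ (rotate ^[ suc k ]) p
    redo (s i) refl = trans (cong s (sym (rot^-period i))) (sym (rotate^-cell (suc k) (rot i)))
    redo sf refl = sym (rotate^-sf (suc k))
    case : p ≡ sf × q ≡ sf → PathF [ Γ ρ ᵀ ] p q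
    case (refl , refl) = singleF refl (inj₁ refl)
    caseᵀ : ∀ p q → Γ ρ q p ≡ true × (p ≡ sf ⊎ q ≡ sf) → p ≡ sf × q ≡ sf
    caseᵀ sf sf _ = refl , refl
    caseᵀ (s _) (s _) (_ , inj₁ ())
    caseᵀ (s _) (s _) (_ , inj₂ ())
    caseᵀ (s _) sf (() , _)
    caseᵀ sf (s _) (() , _)

  _* : Fin 7 → List (Fin 7)
  ρ * = ρs (suc k)
  τ * = [ τ ]
  μ * = [ μᵀ ]
  μᵀ * = [ μ ]
  κ * = [ κ ]
  ξ * = [ ξᵀ ]
  ξᵀ * = [ ξ ]

  star : List (Fin 7) → List (Fin 7)
  star [] = []
  star (x ∷ v) = star v ++ x *

  generator-star : ∀ x → map Γ (x *) ≃ [ Γ x ᵀ ]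
  generator-star ρ = ρᵀ≃ρs
  generator-star τ = ≃-letter (graph-symmetric swap-symmetric)
    where
    swap-symmetric : ∀ {i j} → just (swap01 i) ≡ just j → just (swap01 j) ≡ just i
    swap-symmetric {zero} refl = refl
    swap-symmetric {suc zero} refl = refl
    swap-symmetric {suc (suc _)} refl = refl
  generator-star μ = ≃-refl
  generator-star μᵀ = ≃-refl
  generator-star κ = ≃-letter (graph-symmetric kill-symmetric)
    where
    kill-symmetric : ∀ {i j} → kill0 i ≡ just j → kill0 j ≡ just i
    kill-symmetric {suc _} refl = refl
  generator-star ξ = ≃-refl
  generator-star ξᵀ = ≃-refl

  star-converse : ∀ v → map Γ (star v) ≃ converse (map Γ v)
  star-converse [] = ≃-refl
  star-converse (x ∷ v) = subst (_≃ converse (map Γ (x ∷ v))) (sym (map-++ Γ (star v) (x *)))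
                                (≃-++ (star-converse v) (generator-star x))

  star-path : ∀ v {p q} → Path (map Γ (star v)) p q ⇔ Path (map Γ v) q p
  star-path v {p} {q} = converse-path (map Γ v) ⇔-∘ proj₁ (star-converse v p q)

  star-pathF : ∀ v {p q} → PathF (map Γ (star v)) p q ⇔ PathF (map Γ v) q p
  star-pathF v {p} {q} = converse-pathF (map Γ v) ⇔-∘ proj₂ (star-converse v p q)

  -- Words over ρ, τ, μ, κ compute partial maps of the cells.
  data Op : Set where
    cycle swap merge delete : Op

  gen : Op → Fin 7
  gen cycle = ρ
  gen swap = τ
  gen merge = μ
  gen delete = κ

  act : Op → Cell → Maybe Cell
  act cycle = just ∘ rot
  act swap = just ∘ swap01
  act merge = just ∘ merge10
  act delete = kill0

  keeps : Op → Bool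
  keeps cycle = true
  keeps _ = false

  Γ-gen : ∀ o → Γ (gen o) ≡ graph (keeps o) (act o)
  Γ-gen cycle = refl
  Γ-gen swap = refl
  Γ-gen merge = refl
  Γ-gen delete = refl

  ⟦_⟧ : List Op → Cell → Maybe Cell
  ⟦ [] ⟧ = just
  ⟦ o ∷ v ⟧ i = act o i >>= ⟦ v ⟧

  ops : List Op → List (Fin 7)
  ops = map gen

  ops-separated : ∀ v → All Separated (map Γ (ops v))
  ops-separated [] = []
  ops-separated (o ∷ v) = subst Separated (sym (Γ-gen o)) (graph-separated {keeps o} {act o}) ∷ ops-separated v

  ops-path : ∀ v {i y} → Path (map Γ (ops v)) (s i) y ⇔ (∃[ j ] ⟦ v ⟧ i ≡ just j × y ≡ s j)
  ops-path v = mk⇔ (forward v) (backward v)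
    where
    step⇔ : ∀ o {i y} → Γ (gen o) (s i) y ≡ true ⇔ (∃[ j ] act o i ≡ just j × y ≡ s j)
    step⇔ o {i} {y} = subst (λ a → a (s i) y ≡ true ⇔ (∃[ j ] act o i ≡ just j × y ≡ s j))
                            (sym (Γ-gen o)) graph-step
    forward : ∀ v {i y} → Path (map Γ (ops v)) (s i) y → ∃[ j ] ⟦ v ⟧ i ≡ just j × y ≡ s j
    forward [] stay = _ , refl , refl
    forward (o ∷ v) (move e π) with to (step⇔ o) e
    ... | j , act≡ , refl rewrite act≡ = forward v π
    backward : ∀ v {i y} → (∃[ j ] ⟦ v ⟧ i ≡ just j × y ≡ s j) → Path (map Γ (ops v)) (s i) y
    backward [] (_ , refl , refl) = stay
    backward (o ∷ v) {i} (j , run , y≡) with act o i in act≡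
    ... | just r = move (from (step⇔ o) (r , act≡ , refl)) (backward v (j , run , y≡))

  ⟦⟧-++ : ∀ u v i → ⟦ u ++ v ⟧ i ≡ (⟦ u ⟧ i >>= ⟦ v ⟧)
  ⟦⟧-++ [] v i = refl
  ⟦⟧-++ (o ∷ u) v i with act o i
  ... | nothing = refl
  ... | just j = ⟦⟧-++ u v j

  Total : List Op → (Cell → Cell) → Set
  Total v f = ∀ i → ⟦ v ⟧ i ≡ just (f i)

  total-++ : ∀ u v {f g} → Total u f → Total v g → Total (u ++ v) (g ∘ f)
  total-++ u v tu tv i = trans (⟦⟧-++ u v i) (trans (cong (_>>= ⟦ v ⟧) (tu i)) (tv _))

  total-power : ∀ v {f} → Total v f → ∀ a → Total (concat (replicate a v)) (f ^[ a ])
  total-power v tv zero i = refl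
  total-power v tv (suc a) = total-++ v (concat (replicate a v)) tv (total-power v tv a)

  conjugate : ∀ A B {α β} → Total A α → Total B β → ∀ o i →
              ⟦ A ++ [ o ] ++ B ⟧ i ≡ Maybe.map β (act o (α i))
  conjugate A B {α} tA tB o i =
    trans (⟦⟧-++ A (o ∷ B) i) (trans (cong (_>>= ⟦ o ∷ B ⟧) (tA i)) (after (act o (α i))))
    where
    after : ∀ t → (t >>= ⟦ B ⟧) ≡ Maybe.map _ t
    after nothing = refl
    after (just j) = tB j

  -- The rotation of the cells fixing cell 0: first swap 0 and 1, then rotate.
  shift : Cell → Cell
  shift = rot ∘ swap01

  shift-suc : ∀ j → shift (suc j) ≡ suc (rot j)
  shift-suc zero = refl
  shift-suc (suc j) = refl

  shift^-suc : ∀ c j → (shift ^[ c ]) (suc j) ≡ suc ((rot ^[ c ]) j)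
  shift^-suc = ^-intertwine shift suc shift-suc

  shift^-zero : ∀ c → (shift ^[ c ]) zero ≡ zero
  shift^-zero = ^-fixed shift refl

  shift^-cancel : ∀ c i → c ≤ suc k → (shift ^[ suc k ∸ c ]) ((shift ^[ c ]) i) ≡ i
  shift^-cancel c zero _ = trans (cong (shift ^[ suc k ∸ c ]) (shift^-zero c)) (shift^-zero (suc k ∸ c))
  shift^-cancel c (suc j) c≤ = trans (cong (shift ^[ suc k ∸ c ]) (shift^-suc c j))
                                     (trans (shift^-suc (suc k ∸ c) _) (cong suc (rot^-cancel c j c≤)))

  cycles : ℕ → List Op
  cycles a = concat (replicate a [ cycle ])

  cycles-total : ∀ a → Total (cycles a) (rot ^[ a ])
  cycles-total = total-power [ cycle ] (λ _ → refl)

  shifts : ℕ → List Op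
  shifts c = concat (replicate c (swap ∷ cycle ∷ []))

  shifts-total : ∀ c → Total (shifts c) (shift ^[ c ])
  shifts-total = total-power (swap ∷ cycle ∷ []) (λ _ → refl)

  deleteAt : Cell → List Op
  deleteAt y = cycles (toℕ y) ++ [ delete ] ++ cycles (N ∸ toℕ y)

  private
    deleteAt-conj : ∀ y i → ⟦ deleteAt y ⟧ i ≡ Maybe.map (rot ^[ N ∸ toℕ y ]) (kill0 ((rot ^[ toℕ y ]) i))
    deleteAt-conj y = conjugate (cycles (toℕ y)) (cycles (N ∸ toℕ y))
                                (cycles-total (toℕ y)) (cycles-total (N ∸ toℕ y)) delete

  deleteAt-self : ∀ y → ⟦ deleteAt y ⟧ y ≡ nothing
  deleteAt-self y = trans (deleteAt-conj y y) (cong (Maybe.map (rot ^[ N ∸ toℕ y ]) ∘ kill0) (rot^-self y))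

  deleteAt-other : ∀ y {i} → i ≢ y → ⟦ deleteAt y ⟧ i ≡ just i
  deleteAt-other y {i} i≢y with (rot ^[ toℕ y ]) i in moved | deleteAt-conj y i
  ... | zero | _ = ⊥-elim (i≢y (rot^-injective (toℕ y) (toℕ≤N y) (trans moved (sym (rot^-self y)))))
  ... | suc j | conj = trans conj (cong just (trans (cong (rot ^[ N ∸ toℕ y ]) (sym moved))
                                                     (rot^-cancel (toℕ y) i (toℕ≤N y))))

  record Frame (y z : Cell) : Set where
    field
      into back : List Op
      α β : Cell → Cell
      into-total : Total into α
      back-total : Total back β
      retract : ∀ i → β (α i) ≡ i
      y↦1 : α y ≡ suc zero
      z↦0 : α z ≡ zero

    α-injective : ∀ {i j} → α i ≡ α j → i ≡ j
    α-injective {i} {j} e = trans (sym (retract i)) (trans (cong β e) (retract j))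

    framed : ∀ o i → ⟦ into ++ [ o ] ++ back ⟧ i ≡ Maybe.map β (act o (α i))
    framed = conjugate into back into-total back-total

  -- Rotate z to cell 0, then shift (fixing cell 0) the image of y to cell 1.
  frame : ∀ {y z} → y ≢ z → Frame y z
  frame {y} {z} y≢z with (rot ^[ toℕ z ]) y in y-moved
  ... | zero = ⊥-elim (y≢z (rot^-injective (toℕ z) (toℕ≤N z) (trans y-moved (sym (rot^-self z)))))
  ... | suc t = record
    { into = cycles (toℕ z) ++ shifts (toℕ t)
    ; back = shifts (suc k ∸ toℕ t) ++ cycles (N ∸ toℕ z)
    ; α = (shift ^[ toℕ t ]) ∘ (rot ^[ toℕ z ])
    ; β = (rot ^[ N ∸ toℕ z ]) ∘ (shift ^[ suc k ∸ toℕ t ])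
    ; into-total = total-++ (cycles (toℕ z)) (shifts (toℕ t)) (cycles-total (toℕ z)) (shifts-total (toℕ t))
    ; back-total = total-++ (shifts (suc k ∸ toℕ t)) (cycles (N ∸ toℕ z))
                            (shifts-total (suc k ∸ toℕ t)) (cycles-total (N ∸ toℕ z))
    ; retract = λ i → trans (cong (rot ^[ N ∸ toℕ z ]) (shift^-cancel (toℕ t) _ (<⇒≤ (toℕ<n t))))
                            (rot^-cancel (toℕ z) i (toℕ≤N z))
    ; y↦1 = trans (cong (shift ^[ toℕ t ]) y-moved) (trans (shift^-suc (toℕ t) t) (cong suc (rot^-self t)))
    ; z↦0 = trans (cong (shift ^[ toℕ t ]) (rot^-self z)) (shift^-zero (toℕ t))
    }

  mergeAt : ∀ {y z} → y ≢ z → List Op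
  mergeAt y≢z = into ++ [ merge ] ++ back
    where open Frame (frame y≢z)

  mergeAt-self : ∀ {y z} (y≢z : y ≢ z) → ⟦ mergeAt y≢z ⟧ y ≡ just z
  mergeAt-self {y} {z} y≢z = begin
    ⟦ mergeAt y≢z ⟧ y          ≡⟨ framed merge y ⟩
    just (β (merge10 (α y)))   ≡⟨ cong (just ∘ β ∘ merge10) y↦1 ⟩
    just (β zero)              ≡⟨ cong (just ∘ β) (sym z↦0) ⟩
    just (β (α z))             ≡⟨ cong just (retract z) ⟩
    just z                     ∎
    where
    open Frame (frame y≢z)
    open ≡-Reasoning

  mergeAt-other : ∀ {y z} (y≢z : y ≢ z) {i} → i ≢ y → ⟦ mergeAt y≢z ⟧ i ≡ just i
  mergeAt-other {y} y≢z {i} i≢y = trans (framed merge i) (cong just (trans (cong β (unmoved (α i) not-at-1)) (retract i)))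
    where
    open Frame (frame y≢z)
    not-at-1 : α i ≢ suc zero
    not-at-1 e = i≢y (α-injective (trans e (sym y↦1)))
    unmoved : ∀ j → j ≢ suc zero → merge10 j ≡ j
    unmoved zero _ = refl
    unmoved (suc zero) j≢1 = ⊥-elim (j≢1 refl)
    unmoved (suc (suc _)) _ = refl

  transpose-here : ∀ (y z : Cell) → transpose y z y ≡ z
  transpose-here y z rewrite dec-true (y Fin.≟ y) refl = refl

  transpose-there : ∀ (y z : Cell) → transpose y z z ≡ y
  transpose-there y z with z Fin.≟ y
  ... | yes z≡y = z≡y
  ... | no _ rewrite dec-true (z Fin.≟ z) refl = refl

  transpose-other : ∀ (y z : Cell) {i} → i ≢ y → i ≢ z → transpose y z i ≡ i
  transpose-other y z {i} i≢y i≢z rewrite dec-false (i Fin.≟ y) i≢y | dec-false (i Fin.≟ z) i≢z = refl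

  exchange : Cell → Cell → List Op
  exchange y z with y Fin.≟ z
  ... | yes _ = []
  ... | no y≢z = into ++ [ swap ] ++ back
    where open Frame (frame y≢z)

  exchange-total : ∀ y z → Total (exchange y z) (transpose y z)
  exchange-total y z i with y Fin.≟ z
  ... | yes refl = cong just (sym (same i))
    where
    same : ∀ i → transpose y y i ≡ i
    same i = by-cases (i Fin.≟ y)
      where
      by-cases : Dec (i ≡ y) → transpose y y i ≡ i
      by-cases (yes refl) = transpose-here i i
      by-cases (no i≢y) = transpose-other y y i≢y i≢y
  ... | no y≢z = trans (framed swap i) (cong just (swapped i))
    where
    open Frame (frame y≢z)
    swapped : ∀ i → β (swap01 (α i)) ≡ transpose y z i
    swapped i = by-cases (i Fin.≟ y) (i Fin.≟ z)
      where
      by-cases : Dec (i ≡ y) → Dec (i ≡ z) → β (swap01 (α i)) ≡ transpose y z i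
      by-cases (yes refl) _ =
        trans (cong (β ∘ swap01) y↦1) (trans (cong β (sym z↦0)) (trans (retract z) (sym (transpose-here y z))))
      by-cases (no _) (yes refl) =
        trans (cong (β ∘ swap01) z↦0) (trans (cong β (sym y↦1)) (trans (retract y) (sym (transpose-there y z))))
      by-cases (no i≢y) (no i≢z) =
        trans (cong β (fixed (α i) (λ e → i≢z (α-injective (trans e (sym z↦0))))
                                   (λ e → i≢y (α-injective (trans e (sym y↦1))))))
              (trans (retract i) (sym (transpose-other y z i≢y i≢z)))
        where
        fixed : ∀ j → j ≢ zero → j ≢ suc zero → swap01 j ≡ j
        fixed zero j≢0 _ = ⊥-elim (j≢0 refl)
        fixed (suc zero) _ j≢1 = ⊥-elim (j≢1 refl)
        fixed (suc (suc _)) _ _ = refl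

  move-to : Cell → Maybe Cell → List Op
  move-to y nothing = deleteAt y
  move-to y (just z) with y Fin.≟ z
  ... | yes _ = []
  ... | no y≢z = mergeAt y≢z

  move-to-self : ∀ y t → ⟦ move-to y t ⟧ y ≡ t
  move-to-self y nothing = deleteAt-self y
  move-to-self y (just z) with y Fin.≟ z
  ... | yes y≡z = cong just y≡z
  ... | no y≢z = mergeAt-self y≢z

  move-to-other : ∀ y t {i} → i ≢ y → ⟦ move-to y t ⟧ i ≡ just i
  move-to-other y nothing i≢y = deleteAt-other y i≢y
  move-to-other y (just z) i≢y with y Fin.≟ z
  ... | yes _ = refl
  ... | no y≢z = mergeAt-other y≢z i≢y

  -- A partial map ψ of the cells fixing every cell of its image is computed
  -- by moving each cell y to ψ y in turn: later moves never disturb a cell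
  -- of the image.
  collapse : (ψ : Cell → Maybe Cell) → (∀ {y z} → ψ y ≡ just z → ψ z ≡ just z) →
             ∃[ v ] ∀ i → ⟦ v ⟧ i ≡ ψ i
  collapse ψ idem = moves (allFin N) , λ i → moves-member (allFin N) (∈-allFin i)
    where
    moves : List Cell → List Op
    moves [] = []
    moves (y ∷ ys) = move-to y (ψ y) ++ moves ys

    moves-image : ∀ ys {z} → ψ z ≡ just z → ⟦ moves ys ⟧ z ≡ just z
    moves-image [] _ = refl
    moves-image (y ∷ ys) {z} ψz = trans (⟦⟧-++ (move-to y (ψ y)) (moves ys) z)
                                        (trans (cong (_>>= ⟦ moves ys ⟧) first) (moves-image ys ψz))
      where
      first : ⟦ move-to y (ψ y) ⟧ z ≡ just z
      first with z Fin.≟ y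
      ... | yes refl = trans (move-to-self z (ψ z)) ψz
      ... | no z≢y = move-to-other y (ψ y) z≢y

    moves-member : ∀ ys {i} → i ∈ ys → ⟦ moves ys ⟧ i ≡ ψ i
    moves-member (y ∷ ys) {i} i∈ = trans (⟦⟧-++ (move-to y (ψ y)) (moves ys) i) (by-cases (i Fin.≟ y) i∈)
      where
      settle : ∀ t → ψ i ≡ t → (t >>= ⟦ moves ys ⟧) ≡ ψ i
      settle nothing ψi = sym ψi
      settle (just z) ψi = trans (moves-image ys (idem ψi)) (sym ψi)
      by-cases : Dec (i ≡ y) → i ∈ y ∷ ys → (⟦ move-to y (ψ y) ⟧ i >>= ⟦ moves ys ⟧) ≡ ψ i
      by-cases (yes refl) _ = trans (cong (_>>= ⟦ moves ys ⟧) (move-to-self i (ψ i))) (settle (ψ i) refl)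
      by-cases (no i≢y) (here i≡y) = ⊥-elim (i≢y i≡y)
      by-cases (no i≢y) (there i∈ys) =
        trans (cong (_>>= ⟦ moves ys ⟧) (move-to-other y (ψ y) i≢y)) (moves-member ys i∈ys)

  record Arrangement {m} (src tgt : Fin m → Cell) : Set where
    field
      word : List Op
      perm unperm : Cell → Cell
      computes : Total word perm
      unperm-perm : ∀ i → unperm (perm i) ≡ i
      places : ∀ j → perm (src j) ≡ tgt j

  -- Place src 1,…,m-1 by induction, then exchange the current position of
  -- src 0 with tgt 0; this does not disturb the cells tgt 1,…,m-1.
  arrange : ∀ {m} (src tgt : Fin m → Cell) → Injective _≡_ _≡_ src → Injective _≡_ _≡_ tgt →
            Arrangement src tgt
  arrange {zero} src tgt _ _ = record
    { word = [] ; perm = λ i → i ; unperm = λ i → i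
    ; computes = λ _ → refl ; unperm-perm = λ _ → refl ; places = λ () }
  arrange {suc m} src tgt src-inj tgt-inj = record
    { word = word ++ exchange a b
    ; perm = transpose a b ∘ perm
    ; unperm = unperm ∘ transpose b a
    ; computes = total-++ word (exchange a b) computes (exchange-total a b)
    ; unperm-perm = λ i → trans (cong unperm (transpose-inverse b a)) (unperm-perm i)
    ; places = λ { zero → transpose-here a b
                 ; (suc j) → trans (cong (transpose a b) (places j))
                                   (transpose-other a b (apart-a j) (λ e → apart-b j (tgt-inj e))) }
    }
    where
    open Arrangement (arrange (src ∘ suc) (tgt ∘ suc) (λ e → Fin.suc-injective (src-inj e))
                                                        (λ e → Fin.suc-injective (tgt-inj e)))
    a b : Cell
    a = perm (src zero)
    b = tgt zero
    apart-a : ∀ j → tgt (suc j) ≢ a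
    apart-a j e with src-inj (trans (sym (unperm-perm _)) (trans (cong unperm (trans (places j) e)) (unperm-perm _)))
    ... | ()
    apart-b : ∀ j → suc j ≢ zero
    apart-b j ()

  -- Some word sends each classified cell to the cell of its class and
  -- deletes the unclassified ones: arrange the representatives onto their
  -- cells, then collapse.
  classify : ∀ {m} (class : Cell → Maybe (Fin m)) (rep tgt : Fin m → Cell) →
             (∀ j → class (rep j) ≡ just j) → Injective _≡_ _≡_ tgt →
             ∃[ v ] ∀ i → ⟦ v ⟧ i ≡ Maybe.map tgt (class i)
  classify class rep tgt represents tgt-inj = word ++ collapser , classifies
    where
    rep-injective : Injective _≡_ _≡_ rep
    rep-injective {i} {j} e = just-injective (trans (sym (represents i)) (trans (cong class e) (represents j)))
    open Arrangement (arrange rep tgt rep-injective tgt-inj)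
    -- after the arrangement, cell y carries the original cell unperm y
    ψ : Cell → Maybe Cell
    ψ = Maybe.map tgt ∘ class ∘ unperm
    ψ-idem : ∀ {y z} → ψ y ≡ just z → ψ z ≡ just z
    ψ-idem {y} e with class (unperm y)
    ψ-idem refl | just j = trans (cong (Maybe.map tgt ∘ class) (trans (cong unperm (sym (places j))) (unperm-perm (rep j))))
                                 (cong (Maybe.map tgt) (represents j))
    collapsed : ∃[ v ] ∀ i → ⟦ v ⟧ i ≡ ψ i
    collapsed = collapse ψ ψ-idem
    collapser : List Op
    collapser = proj₁ collapsed
    classifies : ∀ i → ⟦ word ++ collapser ⟧ i ≡ Maybe.map tgt (class i)
    classifies i = begin
      ⟦ word ++ collapser ⟧ i                   ≡⟨ ⟦⟧-++ word collapser i ⟩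
      (⟦ word ⟧ i >>= ⟦ collapser ⟧)            ≡⟨ cong (_>>= ⟦ collapser ⟧) (computes i) ⟩
      ⟦ collapser ⟧ (perm i)                    ≡⟨ proj₂ collapsed (perm i) ⟩
      Maybe.map tgt (class (unperm (perm i)))   ≡⟨ cong (Maybe.map tgt ∘ class) (unperm-perm i) ⟩
      Maybe.map tgt (class i)                   ∎
      where open ≡-Reasoning

  meet : List Op → List Op → List (Fin 7)
  meet A B = ops A ++ star (ops B)

  private
    meet-split : ∀ A B {p q} → Path (map Γ (meet A B)) p q ⇔ Path (map Γ (ops A) ++ map Γ (star (ops B))) p q
    meet-split A B {p} {q} = subst (λ x → Path x p q ⇔ Path (map Γ (ops A) ++ map Γ (star (ops B))) p q)
                                   (sym (map-++ Γ (ops A) (star (ops B)))) (mk⇔ (λ π → π) (λ π → π))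
    meet-splitF : ∀ A B {p q} → PathF (map Γ (meet A B)) p q → PathF (map Γ (ops A) ++ map Γ (star (ops B))) p q
    meet-splitF A B {p} {q} = subst (λ x → PathF x p q → PathF (map Γ (ops A) ++ map Γ (star (ops B))) p q)
                                    (sym (map-++ Γ (ops A) (star (ops B)))) (λ π → π)

  meet-realizes : ∀ A B → Realizes (map Γ (meet A B)) (λ p q → ∃[ c ] ⟦ A ⟧ p ≡ just c × ⟦ B ⟧ q ≡ just c) (λ _ _ → ⊥)
  meet-realizes A B p q = mk⇔ (forward ∘ to (meet-split A B)) (from (meet-split A B) ∘ backward)
                        , mk⇔ (noVisit ∘ meet-splitF A B) λ ()
    where
    forward : Path (map Γ (ops A) ++ map Γ (star (ops B))) (s p) (s q) → ∃[ c ] ⟦ A ⟧ p ≡ just c × ⟦ B ⟧ q ≡ just c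
    forward π with split (map Γ (ops A)) π
    ... | r , π₁ , π₂ with to (ops-path A) π₁
    ... | c , Ap , refl with to (ops-path B) (to (star-path (ops B)) π₂)
    ... | c' , Bq , refl = c , Ap , Bq
    backward : (∃[ c ] ⟦ A ⟧ p ≡ just c × ⟦ B ⟧ q ≡ just c) → Path (map Γ (ops A) ++ map Γ (star (ops B))) (s p) (s q)
    backward (c , Ap , Bq) = join (from (ops-path A) (c , Ap , refl)) (from (star-path (ops B)) (from (ops-path B) (c , Bq , refl)))
    noVisit : ¬ PathF (map Γ (ops A) ++ map Γ (star (ops B))) (s p) (s q)
    noVisit π with splitF (map Γ (ops A)) π
    ... | _ , inj₁ (π₁ , _) = never-visits (ops-separated A) π₁
    ... | r , inj₂ (π₁ , π₂) with to (ops-path A) π₁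
    ... | c , _ , refl = never-visits (ops-separated B) (to (star-pathF (ops B)) π₂)

  meet-closed : ∀ A B → Closed (map Γ (meet A B))
  meet-closed A B π with split (map Γ (ops A)) (to (meet-split A B) π)
  ... | r , π₁ , π₂ with to (ops-path A) π₁
  ... | c , _ , refl = never-leaves (ops-separated B) (to (star-path (ops B)) π₂)

  -- For Q(m)-rankings f, g (m ≤ N): classify the cells by level with respect
  -- to f and to g, placing level j on cell j; the meet of the two classifying
  -- words agrees with c(f,g).
  module _ {m : ℕ} (m≤N : m ≤ N) (f g : Cell → ℕ) (rf : IsQRanking (3 + k) m f) (rg : IsQRanking (3 + k) m g) where

    private
      module F = Levels {3 + k} f rf
      module G = Levels {3 + k} g rg

      tgt : Fin m → Cell
      tgt j = inject≤ j m≤N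

      tgt-injective : Injective _≡_ _≡_ tgt
      tgt-injective = inject≤-injective m≤N m≤N _ _

      by-f : ∃[ v ] ∀ i → ⟦ v ⟧ i ≡ Maybe.map tgt (F.level i)
      by-f = classify F.level F.rep tgt F.level-rep tgt-injective
      by-g : ∃[ v ] ∀ i → ⟦ v ⟧ i ≡ Maybe.map tgt (G.level i)
      by-g = classify G.level G.rep tgt G.level-rep tgt-injective

      map-just⁻ : ∀ {x : Maybe (Fin m)} {c} → Maybe.map tgt x ≡ just c → ∃[ j ] x ≡ just j × tgt j ≡ c
      map-just⁻ {just j} refl = j , refl , refl

      meets⇔ : ∀ p q → SameOddRank (3 + k) f g p q ⇔ (∃[ c ] ⟦ proj₁ by-f ⟧ p ≡ just c × ⟦ proj₁ by-g ⟧ q ≡ just c)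
      meets⇔ p q = mk⇔ forward backward ⇔-∘ same-level f g rf rg p q
        where
        forward : (∃[ j ] F.level p ≡ just j × G.level q ≡ just j) → ∃[ c ] _
        forward (j , fp , gq) = tgt j , trans (proj₂ by-f p) (cong (Maybe.map tgt) fp)
                                      , trans (proj₂ by-g q) (cong (Maybe.map tgt) gq)
        backward : (∃[ c ] ⟦ proj₁ by-f ⟧ p ≡ just c × ⟦ proj₁ by-g ⟧ q ≡ just c) → ∃[ j ] _
        backward (c , Ap , Bq) with map-just⁻ (trans (sym (proj₂ by-f p)) Ap) | map-just⁻ (trans (sym (proj₂ by-g q)) Bq)
        ... | j , fp , refl | j' , gq , tj' = j , fp , trans gq (cong just (tgt-injective tj'))

    c-word : List (Fin 7)
    c-word = meet (proj₁ by-f) (proj₁ by-g)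

    c-word-closed : Closed (map Γ c-word)
    c-word-closed = meet-closed (proj₁ by-f) (proj₁ by-g)

    c-word-agrees : Agree [ c (3 + k) f g ] (map Γ c-word)
    c-word-agrees = realizes-agree (c-realizes f g) (meet-realizes (proj₁ by-f) (proj₁ by-g))
                                   meets⇔ (λ _ _ → mk⇔ (λ ()) (λ ()))

  data Exit (P : Cell → Set) : State (3 + k) → State (3 + k) → Set where
    stays : ∀ {p} → Exit P p p
    exits : ∀ {x} → P x → Exit P (s x) sf

  exit-map : ∀ {P Q : Cell → Set} → (∀ {x} → P x → Q x) → ∀ {p q} → Exit P p q → Exit Q p q
  exit-map _ stays = stays
  exit-map P⇒Q (exits Px) = exits (P⇒Q Px)

  exit-compose : ∀ {P Q p r q} → Exit P p r → Exit Q r q → Exit (λ x → P x ⊎ Q x) p q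
  exit-compose stays stays = stays
  exit-compose stays (exits Qx) = exits (inj₂ Qx)
  exit-compose (exits Px) stays = exits (inj₁ Px)

  exit-decompose : ∀ {P Q p q} → Exit (λ x → P x ⊎ Q x) p q → ∃[ r ] Exit P p r × Exit Q r q
  exit-decompose stays = _ , stays , stays
  exit-decompose (exits (inj₁ Px)) = _ , exits Px , stays
  exit-decompose (exits (inj₂ Qx)) = _ , stays , exits Qx

  ξ-step : ∀ {p q} → Γ ξ p q ≡ true ⇔ Exit (_≡ zero) p q
  ξ-step {s i} {s j} = mk⇔ (λ e → subst (Exit _ (s i) ∘ s) (to (does⇔ (i Fin.≟ j)) e) stays)
                           (λ { stays → from (does⇔ (i Fin.≟ i)) refl })
  ξ-step {s zero} {sf} = mk⇔ (λ _ → exits refl) (λ _ → refl)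
  ξ-step {s (suc i)} {sf} = mk⇔ (λ ()) (λ { (exits ()) })
  ξ-step {sf} {sf} = mk⇔ (λ _ → stays) (λ _ → refl)
  ξ-step {sf} {s _} = mk⇔ (λ ()) (λ ())

  exitAt : Cell → List (Fin 7)
  exitAt x = ρs (toℕ x) ++ ξ ∷ ρs (N ∸ toℕ x)

  exitAt-path : ∀ x {p q} → Path (map Γ (exitAt x)) p q ⇔ Exit (_≡ x) p q
  exitAt-path x {p} {q} = subst (λ w → Path w p q ⇔ Exit (_≡ x) p q) (sym (map-++ Γ (ρs a) (ξ ∷ ρs b)))
                                (mk⇔ forward backward)
    where
    a b : ℕ
    a = toℕ x
    b = N ∸ toℕ x
    round-trip : ∀ p → (rotate ^[ b ]) ((rotate ^[ a ]) p) ≡ p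
    round-trip (s i) = trans (cong (rotate ^[ b ]) (rotate^-cell a i))
                             (trans (rotate^-cell b _) (cong s (rot^-cancel a i (toℕ≤N x))))
    round-trip sf = trans (cong (rotate ^[ b ]) (rotate^-sf a)) (rotate^-sf b)
    at-zero : ∀ p → (rotate ^[ a ]) p ≡ s zero → p ≡ s x
    at-zero (s i) e = cong s (rot^-injective a (toℕ≤N x)
                                (trans (s-injective (trans (sym (rotate^-cell a i)) e)) (sym (rot^-self x))))
      where
      s-injective : ∀ {i j} → s {3 + k} i ≡ s j → i ≡ j
      s-injective refl = refl
    at-zero sf e with trans (sym (rotate^-sf a)) e
    ... | ()
    forward : ∀ {p q} → Path (map Γ (ρs a) ++ map Γ (ξ ∷ ρs b)) p q → Exit (_≡ x) p q
    forward {p} π with split (map Γ (ρs a)) π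
    ... | r , π₁ , move {r = r'} e π₂ with to (ξ-step {r} {r'}) e | to (ρs-path a) π₁ | to (ρs-path b) π₂
    ... | stays | refl | refl = subst (Exit _ p) (sym (round-trip p)) stays
    ... | exits refl | r≡ | refl = subst₂ (Exit _) (sym (at-zero p (sym r≡))) (sym (rotate^-sf b)) (exits refl)
    backward : ∀ {p q} → Exit (_≡ x) p q → Path (map Γ (ρs a) ++ map Γ (ξ ∷ ρs b)) p q
    backward {p} stays = join (from (ρs-path a) refl)
                          (move (from (ξ-step {(rotate ^[ a ]) p}) stays) (from (ρs-path b) (sym (round-trip p))))
    backward (exits refl) = join (from (ρs-path a) refl)
                                 (move (from (ξ-step {(rotate ^[ a ]) (s x)} {sf})
                                             (subst (λ r → Exit _ r sf) (sym (rotate^-cell a x)) (exits (rot^-self x))))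
                                       (from (ρs-path b) (sym (rotate^-sf b))))

  exitAll : List Cell → List (Fin 7)
  exitAll = concatMap exitAt

  exitAll-path : ∀ xs {p q} → Path (map Γ (exitAll xs)) p q ⇔ Exit (_∈ xs) p q
  exitAll-path [] = mk⇔ (λ { stay → stays }) (λ { stays → stay ; (exits ()) })
  exitAll-path (x ∷ xs) {p} {q} = subst (λ w → Path w p q ⇔ Exit (_∈ x ∷ xs) p q)
                                        (sym (map-++ Γ (exitAt x) (exitAll xs))) (mk⇔ forward backward)
    where
    forward : Path (map Γ (exitAt x) ++ map Γ (exitAll xs)) p q → Exit (_∈ x ∷ xs) p q
    forward π with split (map Γ (exitAt x)) π
    ... | r , π₁ , π₂ = exit-map [ here , there ]′
                          (exit-compose (to (exitAt-path x) π₁) (to (exitAll-path xs) π₂))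
    backward : Exit (_∈ x ∷ xs) p q → Path (map Γ (exitAt x) ++ map Γ (exitAll xs)) p q
    backward e with exit-decompose (exit-map (λ { (here x≡) → inj₁ x≡ ; (there x∈) → inj₂ x∈ }) e)
    ... | r , e₁ , e₂ = join (from (exitAt-path x) e₁) (from (exitAll-path xs) e₂)

  exitAll-trapping : ∀ xs → All Trapping (map Γ (exitAll xs))
  exitAll-trapping [] = []
  exitAll-trapping (x ∷ xs) = subst (All Trapping) (sym (map-++ Γ (exitAt x) (exitAll xs)))
                                    (All-++ (exitAt-trapping (toℕ x)) (exitAll-trapping xs))
    where
    ρs-trapping : ∀ a → All Trapping (map Γ (ρs a))
    ρs-trapping a = All.map proj₂ (ρs-separated a)
    exitAt-trapping : ∀ a → All Trapping (map Γ (ρs a ++ ξ ∷ ρs (N ∸ a)))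
    exitAt-trapping a = subst (All Trapping) (sym (map-++ Γ (ρs a) (ξ ∷ ρs (N ∸ a))))
                              (All-++ (ρs-trapping a) ((λ _ → refl) ∷ ρs-trapping (N ∸ a)))

  clear : List (Fin 7)
  clear = ops (swap ∷ swap ∷ [])

  clear-path : ∀ {p y} → Path (map Γ clear) p y → ∃[ i ] p ≡ s i × y ≡ s i
  clear-path {s i} π with to (ops-path (swap ∷ swap ∷ [])) π
  ... | j , swapped , refl = i , refl , cong s (trans (sym (just-injective swapped)) (involution i))
    where
    involution : ∀ i → swap01 (swap01 i) ≡ i
    involution zero = refl
    involution (suc zero) = refl
    involution (suc (suc _)) = refl
  clear-path {sf} (move {r = s _} () _)
  clear-path {sf} (move {r = sf} () _)

  clear-stays : ∀ {i} → Path (map Γ clear) (s i) (s i)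
  clear-stays {i} = from (ops-path (swap ∷ swap ∷ [])) (i , involution i , refl)
    where
    involution : ∀ i → ⟦ swap ∷ swap ∷ [] ⟧ i ≡ just i
    involution zero = refl
    involution (suc zero) = refl
    involution (suc (suc _)) = refl

  clear-unvisited : ∀ {p y} → ¬ PathF (map Γ clear) p y
  clear-unvisited {s _} π = never-visits (ops-separated (swap ∷ swap ∷ [])) π
  clear-unvisited {sf} π with clear-path (forget π)
  ... | _ , () , _

  rank-cells : (Cell → ℕ) → ℕ → List Cell
  rank-cells h r = filter (λ x → h x ≟ r) (allFin N)

  rank-cells⇔ : ∀ h r {x} → x ∈ rank-cells h r ⇔ h x ≡ r
  rank-cells⇔ h r = mk⇔ (proj₂ ∘ ∈-filter⁻ (λ x → h x ≟ r)) (∈-filter⁺ (λ x → h x ≟ r) (∈-allFin _))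

  -- The generator word for d(h,r,r'): cells of rank r may exit to s_f, then
  -- s_f may enter cells of rank r', then s_f is blocked.
  block : (Cell → ℕ) → ℕ → ℕ → List (Fin 7)
  block h r r' = exitAll (rank-cells h r) ++ star (exitAll (rank-cells h r')) ++ clear

  module _ (h : Cell → ℕ) (r r' : ℕ) where

    private
      E Y : Word (3 + k)
      E = map Γ (exitAll (rank-cells h r))
      Y = map Γ (star (exitAll (rank-cells h r')))

      pieces : map Γ (block h r r') ≡ E ++ Y ++ map Γ clear
      pieces = trans (map-++ Γ (exitAll (rank-cells h r)) _) (cong (E ++_) (map-++ Γ _ clear))

      exit⇔ : ∀ {p q} → Path E p q ⇔ Exit (λ x → h x ≡ r) p q
      exit⇔ = mk⇔ (exit-map (to (rank-cells⇔ h r)) ∘ to (exitAll-path _))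
                  (from (exitAll-path _) ∘ exit-map (from (rank-cells⇔ h r)))

      entry⇔ : ∀ {p q} → Path Y p q ⇔ Exit (λ x → h x ≡ r') q p
      entry⇔ = mk⇔ (exit-map (to (rank-cells⇔ h r')) ∘ to (exitAll-path _))
                   (from (exitAll-path _) ∘ exit-map (from (rank-cells⇔ h r')))
               ⇔-∘ star-path (exitAll (rank-cells h r'))

      entry-visits-sf : ∀ {p q} → PathF Y p q → p ≡ sf
      entry-visits-sf π = trappedF (exitAll-trapping (rank-cells h r')) (to (star-pathF (exitAll (rank-cells h r'))) π)

      tail-path : ∀ {z q} → Path (Y ++ map Γ clear) z (s q) → Exit (λ x → h x ≡ r') (s q) z
      tail-path π with split Y π
      ... | z' , π₁ , π₂ with clear-path π₂
      ... | _ , refl , refl = to entry⇔ π₁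

      forward : ∀ {p q} → Path (E ++ Y ++ map Γ clear) (s p) (s q) → p ≡ q ⊎ Jump (3 + k) h r r' p q
      forward π with split E π
      ... | z , π₁ , π₂ with to exit⇔ π₁ | tail-path π₂
      ... | stays | stays = inj₁ refl
      ... | exits hp | exits hq = inj₂ (hp , hq)

      forwardF : ∀ {p q} → PathF (E ++ Y ++ map Γ clear) (s p) (s q) → Jump (3 + k) h r r' p q
      forwardF π with splitF E π
      ... | z , inj₁ (π₁ , π₂) with trappedF (exitAll-trapping (rank-cells h r)) π₁
      ... | refl with to exit⇔ (forget π₁) | tail-path π₂
      ... | exits hp | exits hq = hp , hq
      forwardF π | z , inj₂ (π₁ , π₂) with splitF Y π₂
      ... | _ , inj₂ (_ , π₃) = ⊥-elim (clear-unvisited π₃)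
      ... | z' , inj₁ (π₃ , π₄) with entry-visits-sf π₃
      ... | refl with to exit⇔ π₁ | tail-path (join (forget π₃) π₄)
      ... | exits hp | exits hq = hp , hq

      jump : ∀ {p q} → Jump (3 + k) h r r' p q → PathF (E ++ Y ++ map Γ clear) (s p) (s q)
      jump (hp , hq) = joinF (inj₁ (visit-end (from exit⇔ (exits hp)) , join (from entry⇔ (exits hq)) clear-stays))

      backward : ∀ {p q} → p ≡ q ⊎ Jump (3 + k) h r r' p q → Path (E ++ Y ++ map Γ clear) (s p) (s q)
      backward (inj₁ refl) = join (from exit⇔ stays) (join (from entry⇔ stays) clear-stays)
      backward (inj₂ j) = forget (jump j)

    block-realizes : Realizes (map Γ (block h r r')) (λ p q → p ≡ q ⊎ Jump (3 + k) h r r' p q) (Jump (3 + k) h r r')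
    block-realizes p q rewrite pieces = mk⇔ forward backward , mk⇔ forwardF jump

    block-closed : Closed (map Γ (block h r r'))
    block-closed π rewrite pieces with split E π
    ... | _ , _ , π₂ with split Y π₂
    ... | _ , _ , π₃ with clear-path π₃
    ... | _ , _ , ()

  u-word : (Cell → ℕ) → List (Fin 7)
  u-word h = chain (block h) (valuesDesc (3 + k) h)

  u-word-closed : ∀ h → Closed (map Γ (u-word h))
  u-word-closed h = subst Closed (sym (map-chain Γ (block h) (valuesDesc (3 + k) h)))
                          (chain-closed (block-closed h) (valuesDesc (3 + k) h))

  u-word-agrees : ∀ h → Agree (u (3 + k) h) (map Γ (u-word h))
  u-word-agrees h = subst₂ Agree (sym (u-chain h)) (sym (map-chain Γ (block h) (valuesDesc (3 + k) h)))
    (chain-agree (valuesDesc-decreasing {3 + k} h) (d-closed h) (block-closed h)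
                 (λ {r} {r'} _ → realizes-agree (d-realizes h r r') (block-realizes h r r')
                                                (λ _ _ → ⇔-id _) (λ _ _ → ⇔-id _)))

  representation : ∀ {m} → m ≤ N → ∀ (f g : Cell → ℕ) → IsQRanking (3 + k) m f → IsQRanking (3 + k) m g →
                   Σ (List (Fin 7)) λ v → map Γ v ≈ w (3 + k) f g
  representation m≤N f g rf rg = u-word f ++ C ++ u-word g , Agree⇒≈ (Agree-sym (subst (Agree (w (3 + k) f g)) (sym pieces) agrees))
    where
    C : List (Fin 7)
    C = c-word m≤N f g rf rg
    pieces : map Γ (u-word f ++ C ++ u-word g) ≡ map Γ (u-word f) ++ map Γ C ++ map Γ (u-word g)
    pieces = trans (map-++ Γ (u-word f) _) (cong (map Γ (u-word f) ++_) (map-++ Γ C (u-word g)))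
    agrees : Agree (w (3 + k) f g) (map Γ (u-word f) ++ map Γ C ++ map Γ (u-word g))
    agrees = Agree-++ (u-closed f) (u-word-closed f) (u-word-agrees f)
               (Agree-++ (c-closed f g) (c-word-closed m≤N f g rf rg) (c-word-agrees m≤N f g rf rg) (u-word-agrees g))

-- The theorem: n = 2 and n ≥ 3 are handled separately.
lemma4p8 : (n : ℕ) → 1 < n → (m : ℕ) → 1 ≤ m → m < n → L n m ≡ Lmax n →
    Σ (Fin 7 → Letter n) λ Γ →
      (∀ i j → i ≢ j → ¬ (∀ p q → Γ i p q ≡ Γ j p q))
      × (∀ (f g : S' n → ℕ) → IsQRanking n m f → IsQRanking n m g →
           Σ (List (Fin 7)) λ v → map Γ v ≈ w n f g)
lemma4p8 (suc (suc zero)) _ m 1≤m _ _ =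
  TwoStates.Γ , TwoStates.Γ-distinct , λ f g rf rg → [ zero ] , Agree⇒≈ (Agree-sym (TwoStates.w-agrees m 1≤m f g rf rg))
lemma4p8 (suc (suc (suc k))) _ m _ m<n _ =
  Generators.Γ k , Generators.Γ-distinct k , Generators.representation k (≤-pred m<n)
lemma4p8 (suc zero) (s≤s ()) _ _ _ _
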